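{- Let $n$ be a positive integer and let $p$ be a prime with $p \equiv \pm 1 \pmod n$. Let $T_n(x)\in\mathbb{Z}[x]$ be the $n$th Chebyshev polynomial of the first kind. Then the reduction of $T_n(x)-1$ modulo $p$ splits completely in $\mathbb{F}_p[x]$ (i.e., it is a constant times a product of linear factors over $\mathbb{F}_p$).
   Context: The Chebyshev polynomial of the first kind $T_n(x)\in\mathbb{Z}[x]$ is the polynomial defined by $T_n(\cos\theta)=\cos(n\theta)$. Throughout, $p$ denotes a prime. -}

module Defs where

open import Data.Nat as ℕ using (ℕ; zero; suc)
open import Data.Integer as ℤ using (ℤ; +_; _+_; _*_; -_; _-_)
open import Data.Integer.Divisibility using (_∣_)
open import Data.List using (List; []; _∷_; foldr)
open import Data.Product using (∃; ∃-syntax)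

-- Polynomials over ℤ as coefficient lists, lowest degree first.
Poly : Set
Poly = List ℤ

coeff : Poly → ℕ → ℤ
coeff []       _       = + 0
coeff (a ∷ f)  zero    = a
coeff (a ∷ f)  (suc k) = coeff f k

infixl 6 _⊕_
_⊕_ : Poly → Poly → Poly
[]      ⊕ g       = g
f       ⊕ []      = f
(a ∷ f) ⊕ (b ∷ g) = (a + b) ∷ (f ⊕ g)

_·_ : ℤ → Poly → Poly
c · []      = []
c · (a ∷ f) = (c * a) ∷ (c · f)

X* : Poly → Poly
X* f = + 0 ∷ f

neg : Poly → Poly
neg f = (- + 1) · f

infixl 7 _⊗_
_⊗_ : Poly → Poly → Poly
[]      ⊗ g = []
(a ∷ f) ⊗ g = (a · g) ⊕ X* (f ⊗ g)

const : ℤ → Poly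
const c = c ∷ []

lin : ℤ → Poly
lin r = (- r) ∷ + 1 ∷ []

prodLin : List ℤ → Poly
prodLin = foldr (λ r acc → lin r ⊗ acc) (const (+ 1))

T : ℕ → Poly
T zero            = const (+ 1)
T (suc zero)      = + 0 ∷ + 1 ∷ []
T (suc (suc n))   = ((+ 2) · X* (T (suc n))) ⊕ neg (T n)

-- congruence of integer polynomials modulo p (coefficientwise),
-- i.e. equality of their reductions in 𝔽_p[x].
_≡ₚ_[mod_] : Poly → Poly → ℕ → Set
f ≡ₚ g [mod p ] = ∀ k → (+ p) ∣ (coeff f k - coeff g k)

SplitsMod : ℕ → Poly → Set
SplitsMod p f = ∃[ c ] ∃[ rs ] (f ≡ₚ (c · prodLin rs) [mod p ])

-- Let p be an odd prime. In a ring of characteristic p, if z + w = 2x and z w = 1 then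
-- 2 T_p(x) = z^p + w^p; taking z = x + y, w = x - y and using (u + v)^p = u^p + v^p and
-- Fermat, this is 2x for every x in the prime field. Adjoining √(a² - 1) to 𝔽_p provides
-- such z, w for x = a, so T_p(a) = a for all a ∈ 𝔽_p. Hence F = T_p - x, of degree p with
-- leading coefficient 2^(p-1), is c ∏_{a ∈ 𝔽_p} (x - a) with c ≠ 0. Cassini's identity gives
-- (T_{p+1} - 1)(T_{p-1} - 1) = (T_p - x)² = F², and T_n - 1 divides T_{kn} - 1 since
-- T_{kn} = T_k ∘ T_n and y - 1 divides T_k(y) - 1. So T_n - 1 divides c² ∏ (x - a)², and
-- dividing out one root at a time shows that it splits. For p = 2 only n = 1, 3 occur.
module Submission where

open import Defs
open import Algebra using (CommutativeRing)
open import Data.Empty using (⊥-elim)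
open import Data.Integer as ℤ using (ℤ; +_; -[1+_])
import Data.Integer.Properties as ℤ
open import Data.List using (List; []; _∷_; _++_; length; map; downFrom)
open import Data.Nat as ℕ using (ℕ; zero; suc)
import Data.Nat.Divisibility as ℕ
import Data.Nat.Properties as ℕ
open import Data.Nat.Primality using (Prime)
open import Data.Product using (_,_; ∃-syntax; proj₁)
open import Data.Sum as Sum using (_⊎_; inj₁; inj₂; [_,_]′)
open import Function using (id)
open import Relation.Nullary using (¬_; yes; no)
open import Relation.Binary.PropositionalEquality as ≡ using (_≡_)

module ℤ-Solver {c ℓ} (R : CommutativeRing c ℓ) where
  open CommutativeRing R
  open import Data.Integer using (_⊖_; ∣_∣; sign; _◃_)
  open import Data.Maybe using (Maybe; just; nothing)
  open import Data.Sign as Sign using (Sign)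
  open import Algebra.Properties.Ring ring using (-0#≈0#; -‿+-comm; -‿involutive; -‿distribˡ-*; -‿distribʳ-*)
  open import Algebra.Properties.CommutativeSemigroup +-commutativeSemigroup using (interchange)
  open import Algebra.Properties.Semiring.Mult.TCOptimised semiring using (_×_; 1+×; ×-homo-+; ×1-homo-*)
  open import Algebra.Solver.Ring.AlmostCommutativeRing
    using (fromCommutativeRing; _-Raw-AlmostCommutative⟶_)
  open import Relation.Binary.Reasoning.Setoid setoid

  -- The optimised multiplication has 1 × 1# = 1#, so the solver's con (+ 1) is 1# itself.
  fromℤ : ℤ → Carrier
  fromℤ (+ n)    = n × 1#
  fromℤ -[1+ n ] = - (suc n × 1#)

  private
    fromℤ-⊖ : ∀ m n → fromℤ (m ⊖ n) ≈ m × 1# - n × 1#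
    fromℤ-⊖ m zero rewrite ℤ.⊖-≥ (ℕ.z≤n {m}) = sym (trans (+-congˡ -0#≈0#) (+-identityʳ _))
    fromℤ-⊖ zero (suc n) rewrite ℤ.⊖-< (ℕ.s≤s (ℕ.z≤n {n})) = sym (+-identityˡ _)
    fromℤ-⊖ (suc m) (suc n) rewrite ℤ.[1+m]⊖[1+n]≡m⊖n m n = begin
      fromℤ (m ⊖ n)                     ≈⟨ fromℤ-⊖ m n ⟩
      m × 1# - n × 1#                   ≈⟨ +-identityˡ _ ⟨
      0# + (m × 1# - n × 1#)            ≈⟨ +-congʳ (-‿inverseʳ 1#) ⟨
      (1# - 1#) + (m × 1# - n × 1#)     ≈⟨ interchange 1# (- 1#) (m × 1#) (- (n × 1#)) ⟩
      (1# + m × 1#) + (- 1# - n × 1#)   ≈⟨ +-congˡ (-‿+-comm 1# (n × 1#)) ⟩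
      (1# + m × 1#) - (1# + n × 1#)     ≈⟨ +-cong (1+× m 1#) (-‿cong (1+× n 1#)) ⟨
      suc m × 1# - suc n × 1#           ∎

  fromℤ-homo-+ : ∀ i j → fromℤ (i ℤ.+ j) ≈ fromℤ i + fromℤ j
  fromℤ-homo-+ (+ m)    (+ n)    = ×-homo-+ 1# m n
  fromℤ-homo-+ (+ m)    -[1+ n ] = fromℤ-⊖ m (suc n)
  fromℤ-homo-+ -[1+ m ] (+ n)    = trans (fromℤ-⊖ n (suc m)) (+-comm _ _)
  fromℤ-homo-+ -[1+ m ] -[1+ n ] = begin
    - (suc (suc (m ℕ.+ n)) × 1#)      ≡⟨ ≡.cong (λ k → - (k × 1#)) (≡.sym (ℕ.+-suc (suc m) n)) ⟩
    - ((suc m ℕ.+ suc n) × 1#)        ≈⟨ -‿cong (×-homo-+ 1# (suc m) (suc n)) ⟩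
    - (suc m × 1# + suc n × 1#)       ≈⟨ -‿+-comm _ _ ⟨
    - (suc m × 1#) - suc n × 1#       ∎

  private
    signed : Sign → Carrier → Carrier
    signed Sign.+ x = x
    signed Sign.- x = - x

    signed-cong : ∀ s {x y} → x ≈ y → signed s x ≈ signed s y
    signed-cong Sign.+ x≈y = x≈y
    signed-cong Sign.- x≈y = -‿cong x≈y

    fromℤ-◃ : ∀ s n → fromℤ (s ◃ n) ≈ signed s (n × 1#)
    fromℤ-◃ Sign.+ zero    = refl
    fromℤ-◃ Sign.- zero    = sym -0#≈0#
    fromℤ-◃ Sign.+ (suc n) = refl
    fromℤ-◃ Sign.- (suc n) = refl

    fromℤ-sign-abs : ∀ i → fromℤ i ≈ signed (sign i) (∣ i ∣ × 1#)
    fromℤ-sign-abs (+ n)    = refl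
    fromℤ-sign-abs -[1+ n ] = refl

    signed-* : ∀ s t x y → signed (s Sign.* t) (x * y) ≈ signed s x * signed t y
    signed-* Sign.+ Sign.+ x y = refl
    signed-* Sign.+ Sign.- x y = -‿distribʳ-* x y
    signed-* Sign.- Sign.+ x y = -‿distribˡ-* x y
    signed-* Sign.- Sign.- x y = begin
      x * y             ≈⟨ -‿involutive _ ⟨
      - - (x * y)       ≈⟨ -‿cong (-‿distribˡ-* x y) ⟩
      - (- x * y)       ≈⟨ -‿distribʳ-* (- x) y ⟩
      - x * - y         ∎

  fromℤ-homo-* : ∀ i j → fromℤ (i ℤ.* j) ≈ fromℤ i * fromℤ j
  fromℤ-homo-* i j = begin
    fromℤ (s ◃ (∣ i ∣ ℕ.* ∣ j ∣))                  ≈⟨ fromℤ-◃ s (∣ i ∣ ℕ.* ∣ j ∣) ⟩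
    signed s ((∣ i ∣ ℕ.* ∣ j ∣) × 1#)             ≈⟨ signed-cong s (×1-homo-* ∣ i ∣ ∣ j ∣) ⟩
    signed s (∣ i ∣ × 1# * ∣ j ∣ × 1#)            ≈⟨ signed-* (sign i) (sign j) _ _ ⟩
    signed (sign i) (∣ i ∣ × 1#) * signed (sign j) (∣ j ∣ × 1#)
                                                   ≈⟨ *-cong (fromℤ-sign-abs i) (fromℤ-sign-abs j) ⟨
    fromℤ i * fromℤ j                              ∎
    where s = sign i Sign.* sign j

  fromℤ-homo-‿- : ∀ i → fromℤ (ℤ.- i) ≈ - fromℤ i
  fromℤ-homo-‿- (+ zero)  = sym -0#≈0#
  fromℤ-homo-‿- (+ suc n) = refl
  fromℤ-homo-‿- -[1+ n ]  = sym (-‿involutive _)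

  private
    homomorphism : ℤ.+-*-rawRing -Raw-AlmostCommutative⟶ fromCommutativeRing R
    homomorphism = record
      { ⟦_⟧    = fromℤ
      ; +-homo = fromℤ-homo-+
      ; *-homo = fromℤ-homo-*
      ; -‿homo = fromℤ-homo-‿-
      ; 0-homo = refl
      ; 1-homo = refl
      }

    equal? : ∀ i j → Maybe (fromℤ i ≈ fromℤ j)
    equal? i j with i ℤ.≟ j
    ... | yes ≡.refl = just refl
    ... | no _       = nothing

  open import Algebra.Solver.Ring ℤ.+-*-rawRing (fromCommutativeRing R) homomorphism equal? public

module Chebyshev {c ℓ} (R : CommutativeRing c ℓ) where
  open CommutativeRing R
  open import Data.Nat.Tactic.RingSolver using (solve-∀)
  open import Algebra.Definitions.RawMagma *-rawMagma using (_∣_; _,_)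
  open import Algebra.Properties.Magma.Divisibility *-magma using (∣ʳ-respʳ-≈)
  open import Algebra.Properties.Ring ring using (x≈y⇒x∙y⁻¹≈ε)
  open import Algebra.Properties.Semiring.Exp semiring using (_^_)
  open import Relation.Binary.Reasoning.Setoid setoid
  open ℤ-Solver R using (solve; _:=_; _:+_; _:*_; _:-_; con)

  Tᴿ : ℕ → Carrier → Carrier
  Tᴿ 0             x = 1#
  Tᴿ 1             x = x
  Tᴿ (suc (suc n)) x = (x + x) * Tᴿ (suc n) x - Tᴿ n x

  private
    move-right : ∀ {a b c} → a + b ≈ c → a ≈ c - b
    move-right {a} {b} {c} a+b≈c = begin
      a             ≈⟨ solve 2 (λ a b → a := (a :+ b) :- b) refl a b ⟩
      (a + b) - b   ≈⟨ +-congʳ a+b≈c ⟩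
      c - b         ∎

    move-left : ∀ {a b c} → a ≈ c - b → a + b ≈ c
    move-left {a} {b} {c} a≈c-b = begin
      a + b         ≈⟨ +-congʳ a≈c-b ⟩
      c - b + b     ≈⟨ solve 2 (λ b c → c :- b :+ b := c) refl b c ⟩
      c             ∎

    drop-zero : ∀ {a b} → b ≈ 0# → a + b ≈ a
    drop-zero b≈0 = trans (+-congˡ b≈0) (+-identityʳ _)

    product-step : ∀ x u v a b w t₀ t₁ → u + b ≈ (w + w) * t₁ → v + ((x + x) * b - a) ≈ (w + w) * t₀ →
                   (x + x) * u - v + a ≈ (w + w) * ((x + x) * t₁ - t₀)
    product-step x u v a b w t₀ t₁ h₁ h₂ = begin
      (x + x) * u - v + a                            ≈⟨ regroup x u v a b ⟩
      (x + x) * (u + b) - (v + ((x + x) * b - a))    ≈⟨ +-cong (*-congˡ h₁) (-‿cong h₂) ⟩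
      (x + x) * ((w + w) * t₁) - (w + w) * t₀        ≈⟨ factor x w t₀ t₁ ⟩
      (w + w) * ((x + x) * t₁ - t₀)                  ∎
      where
      regroup : ∀ x u v a b → (x + x) * u - v + a ≈ (x + x) * (u + b) - (v + ((x + x) * b - a))
      regroup = solve 5 (λ x u v a b → (x :+ x) :* u :- v :+ a := (x :+ x) :* (u :+ b) :- (v :+ ((x :+ x) :* b :- a))) refl
      factor : ∀ x w t₀ t₁ → (x + x) * ((w + w) * t₁) - (w + w) * t₀ ≈ (w + w) * ((x + x) * t₁ - t₀)
      factor = solve 4 (λ x w t₀ t₁ → (x :+ x) :* ((w :+ w) :* t₁) :- (w :+ w) :* t₀ := (w :+ w) :* ((x :+ x) :* t₁ :- t₀)) refl

  module _ (x : Carrier) where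

    Tᴿ-cassini : ∀ k → Tᴿ (2 ℕ.+ k) x * Tᴿ k x - Tᴿ (1 ℕ.+ k) x * Tᴿ (1 ℕ.+ k) x ≈ x * x - 1#
    Tᴿ-cassini zero    = solve 1 (λ x → ((x :+ x) :* x :- con (+ 1)) :* con (+ 1) :- x :* x := x :* x :- con (+ 1)) refl x
    Tᴿ-cassini (suc k) = trans (shift x (Tᴿ k x) (Tᴿ (suc k) x)) (Tᴿ-cassini k)
      where
      shift : ∀ x a b → ((x + x) * ((x + x) * b - a) - b) * b - ((x + x) * b - a) * ((x + x) * b - a)
                          ≈ ((x + x) * b - a) * a - b * b
      shift = solve 3 (λ x a b → ((x :+ x) :* ((x :+ x) :* b :- a) :- b) :* b :- ((x :+ x) :* b :- a) :* ((x :+ x) :* b :- a)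
                              := ((x :+ x) :* b :- a) :* a :- b :* b) refl

    Tᴿ-sub-one-product : ∀ m → (Tᴿ (2 ℕ.+ m) x - 1#) * (Tᴿ m x - 1#) ≈ (Tᴿ (1 ℕ.+ m) x - x) * (Tᴿ (1 ℕ.+ m) x - x)
    Tᴿ-sub-one-product m = trans (expand x (Tᴿ m x) (Tᴿ (1 ℕ.+ m) x)) (drop-zero (x≈y⇒x∙y⁻¹≈ε (Tᴿ-cassini m)))
      where
      expand : ∀ x a b → ((x + x) * b - a - 1#) * (a - 1#)
                           ≈ (b - x) * (b - x) + ((((x + x) * b - a) * a - b * b) - (x * x - 1#))
      expand = solve 3 (λ x a b → ((x :+ x) :* b :- a :- con (+ 1)) :* (a :- con (+ 1))
                              := (b :- x) :* (b :- x) :+ ((((x :+ x) :* b :- a) :* a :- b :* b) :- (x :* x :- con (+ 1)))) refl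

    -- 2 Tₘ Tₙ = Tₘ₊ₙ + Tₘ₋ₙ with m = n + i.
    Tᴿ-product : ∀ n i → Tᴿ (n ℕ.+ (n ℕ.+ i)) x + Tᴿ i x ≈ (Tᴿ (n ℕ.+ i) x + Tᴿ (n ℕ.+ i) x) * Tᴿ n x
    Tᴿ-product 0 i = sym (*-identityʳ _)
    Tᴿ-product 1 i = solve 3 (λ x a b → ((x :+ x) :* b :- a) :+ a := (b :+ b) :* x) refl x (Tᴿ i x) (Tᴿ (suc i) x)
    Tᴿ-product (suc (suc n)) i = begin
      Tᴿ (2 ℕ.+ n ℕ.+ (2 ℕ.+ n ℕ.+ i)) x + Tᴿ i x   ≡⟨ ≡.cong (λ k → Tᴿ k x + Tᴿ i x) (outer n i) ⟩
      (x + x) * Tᴿ (3 ℕ.+ N) x - Tᴿ (2 ℕ.+ N) x + Tᴿ i x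
                                                    ≈⟨ product-step x _ _ _ _ _ (Tᴿ n x) (Tᴿ (1 ℕ.+ n) x)
                                                         (reindex (inner₁ n i) (middle₁ n i) (Tᴿ-product (suc n) (suc i)))
                                                         (reindex (inner₂ n i) (middle₂ n i) (Tᴿ-product n (suc (suc i)))) ⟩
      (w + w) * Tᴿ (2 ℕ.+ n) x                      ∎
      where
      N = n ℕ.+ (n ℕ.+ i)
      w = Tᴿ (2 ℕ.+ n ℕ.+ i) x

      reindex : ∀ {j j′ k k′ b t} → j ≡ j′ → k ≡ k′ →
                Tᴿ j x + b ≈ (Tᴿ k x + Tᴿ k x) * t → Tᴿ j′ x + b ≈ (Tᴿ k′ x + Tᴿ k′ x) * t
      reindex ≡.refl ≡.refl h = h

      outer : ∀ n i → 2 ℕ.+ n ℕ.+ (2 ℕ.+ n ℕ.+ i) ≡ 4 ℕ.+ (n ℕ.+ (n ℕ.+ i))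
      outer = solve-∀
      inner₁ : ∀ n i → 1 ℕ.+ n ℕ.+ (1 ℕ.+ n ℕ.+ (1 ℕ.+ i)) ≡ 3 ℕ.+ (n ℕ.+ (n ℕ.+ i))
      inner₁ = solve-∀
      inner₂ : ∀ n i → n ℕ.+ (n ℕ.+ (2 ℕ.+ i)) ≡ 2 ℕ.+ (n ℕ.+ (n ℕ.+ i))
      inner₂ = solve-∀
      middle₁ : ∀ n i → 1 ℕ.+ n ℕ.+ (1 ℕ.+ i) ≡ 2 ℕ.+ n ℕ.+ i
      middle₁ = solve-∀
      middle₂ : ∀ n i → n ℕ.+ (2 ℕ.+ i) ≡ 2 ℕ.+ n ℕ.+ i
      middle₂ = solve-∀

  Tᴿ-∘ : ∀ k n x → Tᴿ (k ℕ.* n) x ≈ Tᴿ k (Tᴿ n x)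
  Tᴿ-∘ 0             n x = refl
  Tᴿ-∘ 1             n x = reflexive (≡.cong (λ j → Tᴿ j x) (ℕ.+-identityʳ n))
  Tᴿ-∘ (suc (suc k)) n x = begin
    Tᴿ (n ℕ.+ (n ℕ.+ k ℕ.* n)) x
      ≈⟨ move-right (Tᴿ-product x n (k ℕ.* n)) ⟩
    (Tᴿ (n ℕ.+ k ℕ.* n) x + Tᴿ (n ℕ.+ k ℕ.* n) x) * y - Tᴿ (k ℕ.* n) x
      ≈⟨ +-cong (*-congʳ (+-cong (Tᴿ-∘ (suc k) n x) (Tᴿ-∘ (suc k) n x))) (-‿cong (Tᴿ-∘ k n x)) ⟩
    (Tᴿ (suc k) y + Tᴿ (suc k) y) * y - Tᴿ k y
      ≈⟨ +-congʳ (swap y (Tᴿ (suc k) y)) ⟩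
    (y + y) * Tᴿ (suc k) y - Tᴿ k y
      ∎
    where
    y = Tᴿ n x
    swap : ∀ y t → (t + t) * y ≈ (y + y) * t
    swap = solve 2 (λ y t → (t :+ t) :* y := (y :+ y) :* t) refl

  sub-one-∣-Tᴿ-sub-one : ∀ k y → (y - 1#) ∣ (Tᴿ k y - 1#)
  sub-one-∣-Tᴿ-sub-one 0             y = 0# , trans (zeroˡ _) (sym (-‿inverseʳ 1#))
  sub-one-∣-Tᴿ-sub-one 1             y = 1# , *-identityˡ _
  sub-one-∣-Tᴿ-sub-one (suc (suc k)) y with sub-one-∣-Tᴿ-sub-one k y | sub-one-∣-Tᴿ-sub-one (suc k) y
  ... | q₀ , h₀ | q₁ , h₁ = (y + y) * q₁ - q₀ + 1# + 1# , (begin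
    ((y + y) * q₁ - q₀ + 1# + 1#) * (y - 1#)                            ≈⟨ expand y q₀ q₁ ⟩
    (y + y) * (q₁ * (y - 1#) + 1#) - (q₀ * (y - 1#) + 1#) - 1#          ≈⟨ +-congʳ (+-cong (*-congˡ (move-left h₁))
                                                                                        (-‿cong (move-left h₀))) ⟩
    (y + y) * Tᴿ (suc k) y - Tᴿ k y - 1#                                ∎)
    where
    expand : ∀ y q₀ q₁ → ((y + y) * q₁ - q₀ + 1# + 1#) * (y - 1#)
                           ≈ (y + y) * (q₁ * (y - 1#) + 1#) - (q₀ * (y - 1#) + 1#) - 1#
    expand = solve 3 (λ y q₀ q₁ → ((y :+ y) :* q₁ :- q₀ :+ con (+ 1) :+ con (+ 1)) :* (y :- con (+ 1))
                               := (y :+ y) :* (q₁ :* (y :- con (+ 1)) :+ con (+ 1)) :- (q₀ :* (y :- con (+ 1)) :+ con (+ 1)) :- con (+ 1)) refl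

  Tᴿ-sub-one-∣ : ∀ {n j} → n ℕ.∣ j → ∀ x → (Tᴿ n x - 1#) ∣ (Tᴿ j x - 1#)
  Tᴿ-sub-one-∣ {n} (ℕ.divides k ≡.refl) x = ∣ʳ-respʳ-≈ (+-congʳ (sym (Tᴿ-∘ k n x))) (sub-one-∣-Tᴿ-sub-one k (Tᴿ n x))

  module _ {x z w : Carrier} (z+w≈2x : z + w ≈ x + x) (zw≈1 : z * w ≈ 1#) where

    Tᴿ-power-sum : ∀ k → Tᴿ k x + Tᴿ k x ≈ z ^ k + w ^ k
    Tᴿ-power-sum 0 = refl
    Tᴿ-power-sum 1 = trans (sym z+w≈2x) (sym (+-cong (*-identityʳ z) (*-identityʳ w)))
    Tᴿ-power-sum (suc (suc k)) = begin
      (x + x) * b - a + ((x + x) * b - a)                ≈⟨ regroup x a b ⟩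
      (x + x) * (b + b) - 1# * (a + a)                   ≈⟨ +-cong (*-cong (sym z+w≈2x) (Tᴿ-power-sum (suc k)))
                                                                    (-‿cong (*-cong (sym zw≈1) (Tᴿ-power-sum k))) ⟩
      (z + w) * (z ^ suc k + w ^ suc k) - z * w * (z ^ k + w ^ k) ≈⟨ newton z w (z ^ k) (w ^ k) ⟩
      z ^ suc (suc k) + w ^ suc (suc k)                  ∎
      where
      a = Tᴿ k x
      b = Tᴿ (suc k) x
      regroup : ∀ x a b → (x + x) * b - a + ((x + x) * b - a) ≈ (x + x) * (b + b) - 1# * (a + a)
      regroup = solve 3 (λ x a b → (x :+ x) :* b :- a :+ ((x :+ x) :* b :- a) := (x :+ x) :* (b :+ b) :- con (+ 1) :* (a :+ a)) refl
      newton : ∀ z w s t → (z + w) * (z * s + w * t) - z * w * (s + t) ≈ z * (z * s) + w * (w * t)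
      newton = solve 4 (λ z w s t → (z :+ w) :* (z :* s :+ w :* t) :- z :* w :* (s :+ t) := z :* (z :* s) :+ w :* (w :* t)) refl

module PrimeBinomials where
  open import Data.Nat using (_∸_; _!)
  open import Data.Nat.Combinatorics using (_C_; k![n∸k]!∣n!)
  open import Data.Nat.Combinatorics.Specification using (nCk≡n!/k![n-k]!)
  open import Data.Nat.Divisibility using (_∣_)
  open import Data.Nat.DivMod using (m/n*n≡m)
  open import Data.Nat.Primality using (euclidsLemma; ¬prime[1])

  prime∤! : ∀ {p} → Prime p → ∀ j → j ℕ.< p → ¬ p ∣ j !
  prime∤! {p} p-prime zero    _   p∣1 = ¬prime[1] (≡.subst Prime (ℕ.∣1⇒≡1 p∣1) p-prime)
  prime∤! {p} p-prime (suc j) j<p p∣j! with euclidsLemma (suc j) (j !) p-prime p∣j!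
  ... | inj₁ p∣1+j = ℕ.<⇒≱ j<p (ℕ.∣⇒≤ p∣1+j)
  ... | inj₂ p∣j!  = prime∤! p-prime j (ℕ.<-trans (ℕ.n<1+n j) j<p) p∣j!

  prime∣C : ∀ {p} → Prime p → ∀ k → 0 ℕ.< k → k ℕ.< p → p ∣ p C k
  prime∣C {p@(suc p-1)} p-prime k 0<k k<p
    with euclidsLemma (p C k) (k ! ℕ.* (p ∸ k) !) p-prime (≡.subst (p ∣_) (≡.sym factorials) (ℕ.m∣m*n (p-1 !)))
    where
    k≤p = ℕ.<⇒≤ k<p
    factorials : (p C k) ℕ.* (k ! ℕ.* (p ∸ k) !) ≡ p !
    factorials = ≡.trans (≡.cong (ℕ._* (k ! ℕ.* (p ∸ k) !)) (nCk≡n!/k![n-k]! k≤p))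
                         (m/n*n≡m {{ℕ._!*_!≢0 k (p ∸ k)}} (k![n∸k]!∣n! k≤p))
  ... | inj₁ p∣C = p∣C
  ... | inj₂ p∣k![p-k]! with euclidsLemma (k !) ((p ∸ k) !) p-prime p∣k![p-k]!
  ...   | inj₁ p∣k!      = ⊥-elim (prime∤! p-prime k k<p p∣k!)
  ...   | inj₂ p∣[p-k]!  = ⊥-elim (prime∤! p-prime (p ∸ k) (ℕ.∸-monoʳ-< {p} {k} {0} 0<k (ℕ.<⇒≤ k<p)) p∣[p-k]!)

open PrimeBinomials using (prime∣C)

module Frobenius {c ℓ} (R : CommutativeRing c ℓ) where
  open CommutativeRing R
  open import Data.Fin as Fin using (toℕ; fromℕ; inject₁)
  import Data.Fin.Properties as Fin
  open import Data.Nat using (_∸_)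
  open import Data.Nat.Combinatorics using (_C_; nCn≡1)
  open import Data.Nat.Divisibility using (divides)
  open import Algebra.Properties.Monoid.Mult +-monoid using (_×_; ×-assocˡ; ×-congʳ)
  open import Algebra.Properties.Monoid.Sum +-monoid using (sum; sum-init-last; sum-cong-≋; sum-replicate-zero)
  open import Algebra.Properties.Ring ring using (+-inverseʳ-unique)
  open import Algebra.Properties.Semiring.Exp semiring using (_^_; ^-congˡ)
  open import Algebra.Properties.Semiring.Mult semiring using (×-assoc-*)
  import Algebra.Properties.CommutativeSemiring.Binomial commutativeSemiring as Binomial
  import Data.Vec.Functional as Vector
  open import Relation.Binary.Reasoning.Setoid setoid
  open Chebyshev R using (Tᴿ; Tᴿ-power-sum)
  open ℤ-Solver R using (solve; _:=_; _:+_; _:-_)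

  module _ (n : ℕ) (p-prime : Prime (suc n)) (char : suc n × 1# ≈ 0#) where
    private
      p = suc n

      1^ : ∀ k → 1# ^ k ≈ 1#
      1^ zero    = refl
      1^ (suc k) = trans (*-identityˡ _) (1^ k)

      p×-vanishes : ∀ a → p × a ≈ 0#
      p×-vanishes a = begin
        p × a          ≈⟨ ×-congʳ p (*-identityˡ a) ⟨
        p × (1# * a)   ≈⟨ ×-assoc-* p 1# a ⟨
        (p × 1#) * a   ≈⟨ *-congʳ char ⟩
        0# * a         ≈⟨ zeroˡ a ⟩
        0#             ∎

      inner-binomial-vanishes : ∀ k → 0 ℕ.< k → k ℕ.< p → ∀ a → (p C k) × a ≈ 0#
      inner-binomial-vanishes k 0<k k<p a with prime∣C p-prime k 0<k k<p
      ... | divides q p∣C = begin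
        (p C k) × a     ≡⟨ ≡.cong (_× a) (≡.trans p∣C (ℕ.*-comm q p)) ⟩
        (p ℕ.* q) × a   ≈⟨ ×-assocˡ a p q ⟨
        p × (q × a)     ≈⟨ p×-vanishes (q × a) ⟩
        0#              ∎

    ^p-distrib-+ : ∀ x y → (x + y) ^ p ≈ x ^ p + y ^ p
    ^p-distrib-+ x y = begin
      (x + y) ^ p                                                  ≈⟨ Binomial.theorem p x y ⟩
      t Fin.zero + sum (Vector.tail t)                             ≈⟨ +-congˡ (sum-init-last (Vector.tail t)) ⟩
      t Fin.zero + (sum (Vector.init (Vector.tail t)) + Vector.last (Vector.tail t))
                                                                   ≈⟨ +-cong first (trans (+-congʳ middle) (+-identityˡ _)) ⟩
      y ^ p + Vector.last (Vector.tail t)                          ≈⟨ +-congˡ last ⟩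
      y ^ p + x ^ p                                                ≈⟨ +-comm _ _ ⟩
      x ^ p + y ^ p                                                ∎
      where
      t = Binomial.binomialTerm x y p
      first : t Fin.zero ≈ y ^ p
      first = trans (+-identityʳ _) (*-identityˡ _)
      middle : sum (Vector.init (Vector.tail t)) ≈ 0#
      middle = trans (sum-cong-≋ {n} {Vector.init (Vector.tail t)} {Vector.replicate n 0#} (λ i →
                 inner-binomial-vanishes (suc (toℕ (inject₁ i))) (ℕ.s≤s ℕ.z≤n)
                   (ℕ.s≤s (≡.subst (ℕ._< n) (≡.sym (Fin.toℕ-inject₁ i)) (Fin.toℕ<n i))) _))
               (sum-replicate-zero n)
      last : Vector.last (Vector.tail t) ≈ x ^ p
      last = begin
        (p C toℕ (fromℕ p)) × (x ^ toℕ (fromℕ p) * y ^ (p ∸ toℕ (fromℕ p)))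
          ≡⟨ ≡.cong (λ j → (p C j) × (x ^ j * y ^ (p ∸ j))) (Fin.toℕ-fromℕ p) ⟩
        (p C p) × (x ^ p * y ^ (p ∸ p))
          ≡⟨ ≡.cong₂ (λ a j → a × (x ^ p * y ^ j)) (nCn≡1 p) (ℕ.n∸n≡0 p) ⟩
        1 × (x ^ p * 1#)
          ≈⟨ trans (+-identityʳ _) (*-identityʳ _) ⟩
        x ^ p ∎

    fermat : ∀ k → (k × 1#) ^ p ≈ k × 1#
    fermat zero    = zeroˡ _
    fermat (suc k) = trans (^p-distrib-+ 1# (k × 1#)) (+-cong (1^ p) (fermat k))

    -‿^p : ∀ y → (- y) ^ p ≈ - (y ^ p)
    -‿^p y = +-inverseʳ-unique (y ^ p) ((- y) ^ p) (begin
      y ^ p + (- y) ^ p  ≈⟨ ^p-distrib-+ y (- y) ⟨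
      (y - y) ^ p        ≈⟨ ^-congˡ p (-‿inverseʳ y) ⟩
      0# ^ p             ≈⟨ zeroˡ _ ⟩
      0#                 ∎)


    Tᴿ-prime : ∀ k {x y z w} → x ≈ k × 1# → z ≈ x + y → w ≈ x - y → z * w ≈ 1# → Tᴿ p x + Tᴿ p x ≈ x + x
    Tᴿ-prime k {x} {y} {z} {w} x≈k z≈x+y w≈x-y zw≈1 = begin
      Tᴿ p x + Tᴿ p x                        ≈⟨ Tᴿ-power-sum z+w≈2x zw≈1 p ⟩
      z ^ p + w ^ p                          ≈⟨ +-cong (^-congˡ p z≈x+y) (^-congˡ p w≈x-y) ⟩
      (x + y) ^ p + (x - y) ^ p              ≈⟨ +-cong (^p-distrib-+ x y) (trans (^p-distrib-+ x (- y)) (+-congˡ (-‿^p y))) ⟩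
      (x ^ p + y ^ p) + (x ^ p - y ^ p)      ≈⟨ cancel (x ^ p) (y ^ p) ⟩
      x ^ p + x ^ p                          ≈⟨ +-cong x^p≈x x^p≈x ⟩
      x + x                                  ∎
      where
      cancel : ∀ a b → (a + b) + (a - b) ≈ a + a
      cancel = solve 2 (λ a b → (a :+ b) :+ (a :- b) := a :+ a) refl
      z+w≈2x : z + w ≈ x + x
      z+w≈2x = trans (+-cong z≈x+y w≈x-y) (cancel x y)
      x^p≈x : x ^ p ≈ x
      x^p≈x = trans (^-congˡ p x≈k) (trans (fermat k) (sym x≈k))

module IntegerPolynomials where
  open import Data.Integer using (_+_; _*_; -_; _-_)
  open import Data.Integer.Tactic.RingSolver using (solve-∀)
  open ≡.≡-Reasoning

  coeff-⊕ : ∀ f g k → coeff (f ⊕ g) k ≡ coeff f k + coeff g k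
  coeff-⊕ []      g       k       = ≡.sym (ℤ.+-identityˡ _)
  coeff-⊕ (a ∷ f) []      k       = ≡.sym (ℤ.+-identityʳ _)
  coeff-⊕ (a ∷ f) (b ∷ g) zero    = ≡.refl
  coeff-⊕ (a ∷ f) (b ∷ g) (suc k) = coeff-⊕ f g k

  coeff-· : ∀ c f k → coeff (c · f) k ≡ c * coeff f k
  coeff-· c []      k       = ≡.sym (ℤ.*-zeroʳ c)
  coeff-· c (a ∷ f) zero    = ≡.refl
  coeff-· c (a ∷ f) (suc k) = coeff-· c f k

  coeff-neg : ∀ f k → coeff (neg f) k ≡ - coeff f k
  coeff-neg f k = ≡.trans (coeff-· _ f k) (ℤ.-1*i≡-i _)

  coeff-⊗-∷ : ∀ a f g k → coeff ((a ∷ f) ⊗ g) k ≡ a * coeff g k + coeff (X* (f ⊗ g)) k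
  coeff-⊗-∷ a f g k = ≡.trans (coeff-⊕ (a · g) (X* (f ⊗ g)) k) (≡.cong (_+ coeff (X* (f ⊗ g)) k) (coeff-· a g k))

  coeff-≥length : ∀ f {k} → length f ℕ.≤ k → coeff f k ≡ + 0
  coeff-≥length []      _           = ≡.refl
  coeff-≥length (b ∷ f) (ℕ.s≤s f≤k) = coeff-≥length f f≤k

  eval : Poly → ℤ → ℤ
  eval []      a = + 0
  eval (b ∷ f) a = b + a * eval f a

  eval-⊕ : ∀ f g a → eval (f ⊕ g) a ≡ eval f a + eval g a
  eval-⊕ []      g       a = ≡.sym (ℤ.+-identityˡ _)
  eval-⊕ (b ∷ f) []      a = ≡.sym (ℤ.+-identityʳ _)
  eval-⊕ (b ∷ f) (c ∷ g) a = ≡.trans (≡.cong (λ e → b + c + a * e) (eval-⊕ f g a)) (shuffle b c a (eval f a) (eval g a))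
    where
    shuffle : ∀ b c a x y → b + c + a * (x + y) ≡ b + a * x + (c + a * y)
    shuffle = solve-∀

  eval-· : ∀ c f a → eval (c · f) a ≡ c * eval f a
  eval-· c []      a = ≡.sym (ℤ.*-zeroʳ c)
  eval-· c (b ∷ f) a = ≡.trans (≡.cong (λ e → c * b + a * e) (eval-· c f a)) (shuffle c b a (eval f a))
    where
    shuffle : ∀ c b a x → c * b + a * (c * x) ≡ c * (b + a * x)
    shuffle = solve-∀

  eval-⊗ : ∀ f g a → eval (f ⊗ g) a ≡ eval f a * eval g a
  eval-⊗ []      g a = ≡.refl
  eval-⊗ (b ∷ f) g a = begin
    eval (b · g ⊕ X* (f ⊗ g)) a                       ≡⟨ eval-⊕ (b · g) (X* (f ⊗ g)) a ⟩
    eval (b · g) a + (+ 0 + a * eval (f ⊗ g) a)       ≡⟨ ≡.cong₂ (λ u v → u + (+ 0 + a * v)) (eval-· b g a) (eval-⊗ f g a) ⟩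
    b * eval g a + (+ 0 + a * (eval f a * eval g a))  ≡⟨ shuffle b a (eval f a) (eval g a) ⟩
    (b + a * eval f a) * eval g a                     ∎
    where
    shuffle : ∀ b a x y → b * y + (+ 0 + a * (x * y)) ≡ (b + a * x) * y
    shuffle = solve-∀

  eval-lin : ∀ r a → eval (lin r) a ≡ a - r
  eval-lin r a = shuffle r a
    where
    shuffle : ∀ r a → - r + a * (+ 1 + a * + 0) ≡ a - r
    shuffle = solve-∀

  -- Synthetic division: f = (x - a) · quotient a f + eval f a.
  quotient : ℤ → Poly → Poly
  quotient a []          = []
  quotient a (b ∷ [])    = []
  quotient a (b ∷ c ∷ g) = eval (c ∷ g) a ∷ quotient a (c ∷ g)

  length-quotient : ∀ a f → length (quotient a f) ≡ length f ℕ.∸ 1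
  length-quotient a []          = ≡.refl
  length-quotient a (b ∷ [])    = ≡.refl
  length-quotient a (b ∷ c ∷ g) = ≡.cong suc (length-quotient a (c ∷ g))

open IntegerPolynomials

module Modulo (p : ℕ) where
  open import Data.Integer using (_+_; _*_; -_; _-_; ∣_∣)
  open import Data.Integer.Divisibility.Signed
    using (_∣_; _∣?_; ∣ᵤ⇒∣; ∣⇒∣ᵤ; ∣m∣n⇒∣m+n; ∣m⇒∣-m; ∣n⇒∣m*n; ∣m⇒∣m*n)
  open import Data.Nat.Primality using (euclidsLemma)
  open import Relation.Nullary using (Dec; map′)
  open import Data.Integer.Tactic.RingSolver using (solve-∀)

  ∣0 : + p ∣ + 0
  ∣0 = ∣ᵤ⇒∣ (ℕ._∣0 p)

  infix 4 _≋_
  record _≋_ (a b : ℤ) : Set where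
    constructor mod
    field ∣difference : + p ∣ a - b
  open _≋_ public

  private
    transport : ∀ {a b} → a ≡ b → + p ∣ a → + p ∣ b
    transport = ≡.subst (+ p ∣_)

  ≡⇒≋ : ∀ {a b} → a ≡ b → a ≋ b
  ≡⇒≋ {a} ≡.refl = mod (transport (≡.sym (ℤ.+-inverseʳ a)) ∣0)

  ≋-refl : ∀ {a} → a ≋ a
  ≋-refl = ≡⇒≋ ≡.refl

  ≋-sym : ∀ {a b} → a ≋ b → b ≋ a
  ≋-sym {a} {b} (mod p∣a-b) = mod (transport (negate a b) (∣m⇒∣-m p∣a-b))
    where
    negate : ∀ a b → - (a - b) ≡ b - a
    negate = solve-∀

  ≋-trans : ∀ {a b c} → a ≋ b → b ≋ c → a ≋ c
  ≋-trans {a} {b} {c} (mod p∣a-b) (mod p∣b-c) = mod (transport (telescope a b c) (∣m∣n⇒∣m+n p∣a-b p∣b-c))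
    where
    telescope : ∀ a b c → (a - b) + (b - c) ≡ a - c
    telescope = solve-∀

  +-cong : ∀ {a a′ b b′} → a ≋ a′ → b ≋ b′ → a + b ≋ a′ + b′
  +-cong {a} {a′} {b} {b′} (mod p∣a-a′) (mod p∣b-b′) = mod (transport (regroup a a′ b b′) (∣m∣n⇒∣m+n p∣a-a′ p∣b-b′))
    where
    regroup : ∀ a a′ b b′ → (a - a′) + (b - b′) ≡ (a + b) - (a′ + b′)
    regroup = solve-∀

  *-cong : ∀ {a a′ b b′} → a ≋ a′ → b ≋ b′ → a * b ≋ a′ * b′
  *-cong {a} {a′} {b} {b′} (mod p∣a-a′) (mod p∣b-b′) =
    mod (transport (regroup a a′ b b′) (∣m∣n⇒∣m+n (∣m⇒∣m*n b p∣a-a′) (∣n⇒∣m*n a′ p∣b-b′)))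
    where
    regroup : ∀ a a′ b b′ → (a - a′) * b + a′ * (b - b′) ≡ a * b - a′ * b′
    regroup = solve-∀

  -‿cong : ∀ {a a′} → a ≋ a′ → - a ≋ - a′
  -‿cong {a} {a′} (mod p∣a-a′) = mod (transport (regroup a a′) (∣m⇒∣-m p∣a-a′))
    where
    regroup : ∀ a a′ → - (a - a′) ≡ - a - - a′
    regroup = solve-∀

  ∣⇒≋0 : ∀ {a} → + p ∣ a → a ≋ + 0
  ∣⇒≋0 {a} p∣a = mod (transport (≡.sym (ℤ.+-identityʳ a)) p∣a)

  ≋0⇒∣ : ∀ {a} → a ≋ + 0 → + p ∣ a
  ≋0⇒∣ {a} (mod p∣a-0) = transport (ℤ.+-identityʳ a) p∣a-0

  ≋0⇒≋ : ∀ {a b} → a - b ≋ + 0 → a ≋ b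
  ≋0⇒≋ a-b≋0 = mod (≋0⇒∣ a-b≋0)

  ≋⇒≋0 : ∀ {a b} → a ≋ b → a - b ≋ + 0
  ≋⇒≋0 (mod p∣a-b) = ∣⇒≋0 p∣a-b

  p≋0 : + p ≋ + 0
  p≋0 = ∣⇒≋0 (∣ᵤ⇒∣ (ℕ.∣-refl {p}))

  _≋0? : ∀ a → Dec (a ≋ + 0)
  a ≋0? = map′ ∣⇒≋0 ≋0⇒∣ (+ p ∣? a)

  ≋0-euclid : Prime p → ∀ {a b} → a * b ≋ + 0 → a ≋ + 0 ⊎ b ≋ + 0
  ≋0-euclid p-prime {a} {b} ab≋0 =
    Sum.map (λ p∣a → ∣⇒≋0 (∣ᵤ⇒∣ p∣a)) (λ p∣b → ∣⇒≋0 (∣ᵤ⇒∣ p∣b))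
      (euclidsLemma ∣ a ∣ ∣ b ∣ p-prime (≡.subst (p ℕ.∣_) (ℤ.abs-* a b) (∣⇒∣ᵤ (≋0⇒∣ ab≋0))))

  small-≉0 : ∀ {d} → 0 ℕ.< d → d ℕ.< p → ¬ + d ≋ + 0
  small-≉0 0<d d<p d≋0 = ℕ.<⇒≱ d<p (ℕ.∣⇒≤ {{ℕ.>-nonZero 0<d}} (∣⇒∣ᵤ (≋0⇒∣ d≋0)))

  distinct-residues : ∀ {m n} → m ℕ.< n → n ℕ.< p → ¬ + m - + n ≋ + 0
  distinct-residues {m} {n} m<n n<p m-n≋0 =
    ℕ.<⇒≱ (ℕ.≤-<-trans (ℕ.m∸n≤m n m) n<p) (ℕ.∣⇒≤ {{ℕ.>-nonZero (ℕ.m<n⇒0<n∸m m<n)}} p∣n-m)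
    where
    p∣n-m : p ℕ.∣ n ℕ.∸ m
    p∣n-m = ≡.subst (p ℕ.∣_) (≡.trans (≡.cong ∣_∣ (ℤ.[+m]-[+n]≡m⊖n m n)) (ℤ.∣⊖∣-< m<n))
                    (∣⇒∣ᵤ (≋0⇒∣ m-n≋0))

  2^-≉0 : Prime p → 2 ℕ.< p → ∀ k → ¬ + (2 ℕ.^ k) ≋ + 0
  2^-≉0 p-prime 2<p zero    1≋0  = small-≉0 (ℕ.s≤s ℕ.z≤n) (ℕ.<-trans (ℕ.s≤s (ℕ.s≤s ℕ.z≤n)) 2<p) 1≋0
  2^-≉0 p-prime 2<p (suc k) 2ᵏ⁺¹≋0 with ≋0-euclid p-prime (≡.subst (_≋ + 0) (ℤ.pos-* 2 (2 ℕ.^ k)) 2ᵏ⁺¹≋0)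
  ... | inj₁ 2≋0  = small-≉0 (ℕ.s≤s ℕ.z≤n) 2<p 2≋0
  ... | inj₂ 2ᵏ≋0 = 2^-≉0 p-prime 2<p k 2ᵏ≋0

module PolynomialsModulo (p : ℕ) where
  open Modulo p
  open import Data.Product using (_×_)
  open import Data.Integer using (_+_; _*_; -_; _-_)
  open import Data.Integer.Tactic.RingSolver using (solve-∀)
  open import Data.Integer.Divisibility.Signed using (∣⇒∣ᵤ)
  open import Relation.Binary.Bundles using (Setoid)
  import Relation.Binary.Reasoning.Setoid as SetoidReasoning

  infix 4 _≅_
  record _≅_ (f g : Poly) : Set where
    constructor coeffwise
    field coeff-≋ : ∀ k → coeff f k ≋ coeff g k
  open _≅_ public

  ≡ᶜ⇒≅ : ∀ {f g} → (∀ k → coeff f k ≡ coeff g k) → f ≅ g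
  ≡ᶜ⇒≅ eq = coeffwise λ k → ≡⇒≋ (eq k)

  ≅-refl : ∀ {f} → f ≅ f
  ≅-refl = coeffwise λ k → ≋-refl

  ≅-sym : ∀ {f g} → f ≅ g → g ≅ f
  ≅-sym f≅g = coeffwise λ k → ≋-sym (coeff-≋ f≅g k)

  ≅-trans : ∀ {f g h} → f ≅ g → g ≅ h → f ≅ h
  ≅-trans f≅g g≅h = coeffwise λ k → ≋-trans (coeff-≋ f≅g k) (coeff-≋ g≅h k)

  ≅-setoid : Setoid _ _
  ≅-setoid = record
    { Carrier = Poly ; _≈_ = _≅_
    ; isEquivalence = record { refl = ≅-refl ; sym = ≅-sym ; trans = ≅-trans } }

  open SetoidReasoning ≅-setoid

  ⊕-cong : ∀ {f f′ g g′} → f ≅ f′ → g ≅ g′ → f ⊕ g ≅ f′ ⊕ g′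
  ⊕-cong {f} {f′} {g} {g′} f≅f′ g≅g′ = coeffwise λ k →
    ≡.subst₂ _≋_ (≡.sym (coeff-⊕ f g k)) (≡.sym (coeff-⊕ f′ g′ k)) (+-cong (coeff-≋ f≅f′ k) (coeff-≋ g≅g′ k))

  ·-congʳ : ∀ c {f f′} → f ≅ f′ → c · f ≅ c · f′
  ·-congʳ c {f} {f′} f≅f′ = coeffwise λ k →
    ≡.subst₂ _≋_ (≡.sym (coeff-· c f k)) (≡.sym (coeff-· c f′ k)) (*-cong (≋-refl {c}) (coeff-≋ f≅f′ k))

  X*-cong : ∀ {f f′} → f ≅ f′ → X* f ≅ X* f′
  X*-cong f≅f′ = coeffwise λ { zero → ≋-refl ; (suc k) → coeff-≋ f≅f′ k }

  ⊕-comm : ∀ f g → f ⊕ g ≅ g ⊕ f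
  ⊕-comm f g = ≡ᶜ⇒≅ λ k → ≡.trans (coeff-⊕ f g k) (≡.trans (ℤ.+-comm (coeff f k) (coeff g k)) (≡.sym (coeff-⊕ g f k)))

  ⊕-assoc : ∀ f g h → (f ⊕ g) ⊕ h ≅ f ⊕ (g ⊕ h)
  ⊕-assoc f g h = ≡ᶜ⇒≅ λ k → ≡.trans (≡.trans (coeff-⊕ (f ⊕ g) h k) (≡.cong (_+ coeff h k) (coeff-⊕ f g k)))
    (≡.trans (ℤ.+-assoc (coeff f k) (coeff g k) (coeff h k))
      (≡.sym (≡.trans (coeff-⊕ f (g ⊕ h) k) (≡.cong (λ e → coeff f k + e) (coeff-⊕ g h k)))))

  ⊕-identityʳ : ∀ f → f ⊕ [] ≅ f
  ⊕-identityʳ f = ≡ᶜ⇒≅ λ k → ≡.trans (coeff-⊕ f [] k) (ℤ.+-identityʳ (coeff f k))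

  ⊕-inverseʳ : ∀ f → f ⊕ neg f ≅ []
  ⊕-inverseʳ f = ≡ᶜ⇒≅ λ k → ≡.trans (coeff-⊕ f (neg f) k)
    (≡.trans (≡.cong (λ e → coeff f k + e) (coeff-neg f k)) (ℤ.+-inverseʳ (coeff f k)))

  ⊕-interchange : ∀ a b c d → (a ⊕ b) ⊕ (c ⊕ d) ≅ (a ⊕ c) ⊕ (b ⊕ d)
  ⊕-interchange a b c d = ≡ᶜ⇒≅ λ k →
    ≡.trans (≡.trans (coeff-⊕ (a ⊕ b) (c ⊕ d) k) (≡.cong₂ _+_ (coeff-⊕ a b k) (coeff-⊕ c d k)))
      (≡.trans (interchange (coeff a k) (coeff b k) (coeff c k) (coeff d k))
        (≡.sym (≡.trans (coeff-⊕ (a ⊕ c) (b ⊕ d) k) (≡.cong₂ _+_ (coeff-⊕ a c k) (coeff-⊕ b d k)))))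
    where
    interchange : ∀ A B C D → (A + B) + (C + D) ≡ (A + C) + (B + D)
    interchange = solve-∀

  ·-distrib-⊕ : ∀ c f g → c · (f ⊕ g) ≅ c · f ⊕ c · g
  ·-distrib-⊕ c f g = ≡ᶜ⇒≅ λ k →
    ≡.trans (≡.trans (coeff-· c (f ⊕ g) k) (≡.cong (c *_) (coeff-⊕ f g k)))
      (≡.trans (ℤ.*-distribˡ-+ c _ _)
        (≡.sym (≡.trans (coeff-⊕ (c · f) (c · g) k) (≡.cong₂ _+_ (coeff-· c f k) (coeff-· c g k)))))

  +-distrib-· : ∀ c d f → (c + d) · f ≅ c · f ⊕ d · f
  +-distrib-· c d f = ≡ᶜ⇒≅ λ k →
    ≡.trans (coeff-· (c + d) f k)
      (≡.trans (ℤ.*-distribʳ-+ (coeff f k) c d)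
        (≡.sym (≡.trans (coeff-⊕ (c · f) (d · f) k) (≡.cong₂ _+_ (coeff-· c f k) (coeff-· d f k)))))

  ·-assoc : ∀ c d f → c · (d · f) ≅ (c * d) · f
  ·-assoc c d f = ≡ᶜ⇒≅ λ k →
    ≡.trans (coeff-· c (d · f) k) (≡.trans (≡.cong (c *_) (coeff-· d f k))
      (≡.trans (≡.sym (ℤ.*-assoc c d _)) (≡.sym (coeff-· (c * d) f k))))

  ·-comm-scalars : ∀ c d f → c · (d · f) ≅ d · (c · f)
  ·-comm-scalars c d f = ≅-trans (·-assoc c d f)
    (≅-trans (≡ᶜ⇒≅ λ k → ≡.cong (λ e → coeff (e · f) k) (ℤ.*-comm c d)) (≅-sym (·-assoc d c f)))

  0· : ∀ f → (+ 0) · f ≅ []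
  0· f = ≡ᶜ⇒≅ (coeff-· (+ 0) f)

  1· : ∀ f → (+ 1) · f ≅ f
  1· f = ≡ᶜ⇒≅ λ k → ≡.trans (coeff-· (+ 1) f k) (ℤ.*-identityˡ _)

  X*-⊕ : ∀ f g → X* (f ⊕ g) ≅ X* f ⊕ X* g
  X*-⊕ f g = ≡ᶜ⇒≅ λ { zero → ≡.refl ; (suc k) → ≡.refl }

  X*-· : ∀ c f → X* (c · f) ≅ c · X* f
  X*-· c f = ≡ᶜ⇒≅ λ { zero → ≡.sym (ℤ.*-zeroʳ c) ; (suc k) → ≡.refl }

  X*-[] : X* [] ≅ []
  X*-[] = ≡ᶜ⇒≅ λ { zero → ≡.refl ; (suc k) → ≡.refl }

  ·-const-one : ∀ a → a · const (+ 1) ≅ const a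
  ·-const-one a = ≡ᶜ⇒≅ λ { zero → ℤ.*-identityʳ a ; (suc k) → ≡.refl }

  ∷-split : ∀ a f → a ∷ f ≅ const a ⊕ X* f
  ∷-split a f = ≡ᶜ⇒≅ λ { zero → ≡.sym (ℤ.+-identityʳ a) ; (suc k) → ≡.refl }

  ⊗-congʳ : ∀ f {g g′} → g ≅ g′ → f ⊗ g ≅ f ⊗ g′
  ⊗-congʳ []      g≅g′ = ≅-refl
  ⊗-congʳ (a ∷ f) g≅g′ = ⊕-cong (·-congʳ a g≅g′) (X*-cong (⊗-congʳ f g≅g′))

  ⊗-·ˡ : ∀ c f g → (c · f) ⊗ g ≅ c · (f ⊗ g)
  ⊗-·ˡ c []      g = ≅-refl
  ⊗-·ˡ c (a ∷ f) g = begin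
    (c * a) · g ⊕ X* ((c · f) ⊗ g)  ≈⟨ ⊕-cong (≅-sym (·-assoc c a g)) (X*-cong (⊗-·ˡ c f g)) ⟩
    c · (a · g) ⊕ X* (c · (f ⊗ g))  ≈⟨ ⊕-cong (≅-refl {c · (a · g)}) (X*-· c (f ⊗ g)) ⟩
    c · (a · g) ⊕ c · X* (f ⊗ g)    ≈⟨ ·-distrib-⊕ c (a · g) (X* (f ⊗ g)) ⟨
    c · (a · g ⊕ X* (f ⊗ g))        ∎

  ⊗-·ʳ : ∀ c f g → f ⊗ (c · g) ≅ c · (f ⊗ g)
  ⊗-·ʳ c []      g = ≅-refl
  ⊗-·ʳ c (a ∷ f) g = begin
    a · (c · g) ⊕ X* (f ⊗ (c · g))  ≈⟨ ⊕-cong (·-comm-scalars a c g) (X*-cong (⊗-·ʳ c f g)) ⟩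
    c · (a · g) ⊕ X* (c · (f ⊗ g))  ≈⟨ ⊕-cong (≅-refl {c · (a · g)}) (X*-· c (f ⊗ g)) ⟩
    c · (a · g) ⊕ c · X* (f ⊗ g)    ≈⟨ ·-distrib-⊕ c (a · g) (X* (f ⊗ g)) ⟨
    c · (a · g ⊕ X* (f ⊗ g))        ∎

  ⊗-distribʳ : ∀ f g h → (f ⊕ g) ⊗ h ≅ f ⊗ h ⊕ g ⊗ h
  ⊗-distribʳ []      g       h = ≅-refl
  ⊗-distribʳ (a ∷ f) []      h = ≅-sym (⊕-identityʳ _)
  ⊗-distribʳ (a ∷ f) (b ∷ g) h = begin
    (a + b) · h ⊕ X* ((f ⊕ g) ⊗ h)                  ≈⟨ ⊕-cong (+-distrib-· a b h) (X*-cong (⊗-distribʳ f g h)) ⟩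
    (a · h ⊕ b · h) ⊕ X* (f ⊗ h ⊕ g ⊗ h)            ≈⟨ ⊕-cong (≅-refl {a · h ⊕ b · h}) (X*-⊕ (f ⊗ h) (g ⊗ h)) ⟩
    (a · h ⊕ b · h) ⊕ (X* (f ⊗ h) ⊕ X* (g ⊗ h))     ≈⟨ ⊕-interchange (a · h) (b · h) (X* (f ⊗ h)) (X* (g ⊗ h)) ⟩
    (a · h ⊕ X* (f ⊗ h)) ⊕ (b · h ⊕ X* (g ⊗ h))     ∎

  ⊗-distribˡ : ∀ f g h → f ⊗ (g ⊕ h) ≅ f ⊗ g ⊕ f ⊗ h
  ⊗-distribˡ []      g h = ≅-refl
  ⊗-distribˡ (a ∷ f) g h = begin
    a · (g ⊕ h) ⊕ X* (f ⊗ (g ⊕ h))                  ≈⟨ ⊕-cong (·-distrib-⊕ a g h)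
                                                                (≅-trans (X*-cong (⊗-distribˡ f g h)) (X*-⊕ (f ⊗ g) (f ⊗ h))) ⟩
    (a · g ⊕ a · h) ⊕ (X* (f ⊗ g) ⊕ X* (f ⊗ h))     ≈⟨ ⊕-interchange (a · g) (a · h) (X* (f ⊗ g)) (X* (f ⊗ h)) ⟩
    (a · g ⊕ X* (f ⊗ g)) ⊕ (a · h ⊕ X* (f ⊗ h))     ∎

  ⊗-X*ˡ : ∀ f g → X* f ⊗ g ≅ X* (f ⊗ g)
  ⊗-X*ˡ f g = ⊕-cong (0· g) ≅-refl

  ⊗-X*ʳ : ∀ f g → f ⊗ X* g ≅ X* (f ⊗ g)
  ⊗-X*ʳ []      g = ≅-sym X*-[]
  ⊗-X*ʳ (a ∷ f) g = begin
    a · X* g ⊕ X* (f ⊗ X* g)        ≈⟨ ⊕-cong (≅-sym (X*-· a g)) (X*-cong (⊗-X*ʳ f g)) ⟩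
    X* (a · g) ⊕ X* (X* (f ⊗ g))    ≈⟨ X*-⊕ (a · g) (X* (f ⊗ g)) ⟨
    X* (a · g ⊕ X* (f ⊗ g))         ∎

  ⊗-identityˡ : ∀ f → const (+ 1) ⊗ f ≅ f
  ⊗-identityˡ f = ≅-trans (⊕-cong (1· f) X*-[]) (⊕-identityʳ f)

  ⊗-identityʳ : ∀ f → f ⊗ const (+ 1) ≅ f
  ⊗-identityʳ []      = ≅-refl
  ⊗-identityʳ (a ∷ f) = ≅-trans (⊕-cong (·-const-one a) (X*-cong (⊗-identityʳ f))) (≅-sym (∷-split a f))

  ⊗-zeroʳ : ∀ f → f ⊗ [] ≅ []
  ⊗-zeroʳ []      = ≅-refl
  ⊗-zeroʳ (a ∷ f) = ≅-trans (X*-cong (⊗-zeroʳ f)) X*-[]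

  ⊗-const : ∀ g a → g ⊗ const a ≅ a · g
  ⊗-const g a = begin
    g ⊗ const a                  ≈⟨ ⊗-congʳ g (≅-sym (·-const-one a)) ⟩
    g ⊗ (a · const (+ 1))        ≈⟨ ⊗-·ʳ a g (const (+ 1)) ⟩
    a · (g ⊗ const (+ 1))        ≈⟨ ·-congʳ a (⊗-identityʳ g) ⟩
    a · g                        ∎

  ⊗-∷ʳ : ∀ g a f → g ⊗ (a ∷ f) ≅ a · g ⊕ X* (g ⊗ f)
  ⊗-∷ʳ g a f = begin
    g ⊗ (a ∷ f)                  ≈⟨ ⊗-congʳ g (∷-split a f) ⟩
    g ⊗ (const a ⊕ X* f)         ≈⟨ ⊗-distribˡ g (const a) (X* f) ⟩
    g ⊗ const a ⊕ g ⊗ X* f       ≈⟨ ⊕-cong (⊗-const g a) (⊗-X*ʳ g f) ⟩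
    a · g ⊕ X* (g ⊗ f)           ∎

  ⊗-comm : ∀ f g → f ⊗ g ≅ g ⊗ f
  ⊗-comm []      g = ≅-sym (⊗-zeroʳ g)
  ⊗-comm (a ∷ f) g = ≅-trans (⊕-cong (≅-refl {a · g}) (X*-cong (⊗-comm f g))) (≅-sym (⊗-∷ʳ g a f))

  ⊗-assoc : ∀ f g h → (f ⊗ g) ⊗ h ≅ f ⊗ (g ⊗ h)
  ⊗-assoc []      g h = ≅-refl
  ⊗-assoc (a ∷ f) g h = begin
    (a · g ⊕ X* (f ⊗ g)) ⊗ h          ≈⟨ ⊗-distribʳ (a · g) (X* (f ⊗ g)) h ⟩
    (a · g) ⊗ h ⊕ X* (f ⊗ g) ⊗ h      ≈⟨ ⊕-cong (⊗-·ˡ a g h) (≅-trans (⊗-X*ˡ (f ⊗ g) h) (X*-cong (⊗-assoc f g h))) ⟩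
    a · (g ⊗ h) ⊕ X* (f ⊗ (g ⊗ h))    ∎

  ⊗-cong : ∀ {f f′ g g′} → f ≅ f′ → g ≅ g′ → f ⊗ g ≅ f′ ⊗ g′
  ⊗-cong {f} {f′} {g} {g′} f≅f′ g≅g′ = begin
    f ⊗ g     ≈⟨ ⊗-congʳ f g≅g′ ⟩
    f ⊗ g′    ≈⟨ ⊗-comm f g′ ⟩
    g′ ⊗ f    ≈⟨ ⊗-congʳ g′ f≅f′ ⟩
    g′ ⊗ f′   ≈⟨ ⊗-comm g′ f′ ⟩
    f′ ⊗ g′   ∎

  ℤₚ[X] : CommutativeRing _ _
  ℤₚ[X] = record
    { Carrier = Poly ; _≈_ = _≅_ ; _+_ = _⊕_ ; _*_ = _⊗_ ; -_ = neg ; 0# = [] ; 1# = const (+ 1)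
    ; isCommutativeRing = record
      { isRing = record
        { +-isAbelianGroup = record
          { isGroup = record
            { isMonoid = record
              { isSemigroup = record
                { isMagma = record { isEquivalence = Setoid.isEquivalence ≅-setoid ; ∙-cong = ⊕-cong }
                ; assoc = ⊕-assoc }
              ; identity = (λ f → ≅-refl) , ⊕-identityʳ }
            ; inverse = (λ f → ≅-trans (⊕-comm (neg f) f) (⊕-inverseʳ f)) , ⊕-inverseʳ
            ; ⁻¹-cong = ·-congʳ _ }
          ; comm = ⊕-comm }
        ; *-cong = ⊗-cong
        ; *-assoc = ⊗-assoc
        ; *-identity = ⊗-identityˡ , ⊗-identityʳ
        ; distrib = ⊗-distribˡ , λ h f g → ⊗-distribʳ f g h }
      ; *-comm = ⊗-comm } }

  open import Algebra.Properties.Ring (CommutativeRing.ring ℤₚ[X])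
    using (x[y-z]≈xy-xz; x≈y⇒x∙y⁻¹≈ε; x∙y⁻¹≈ε⇒x≈y)
  open import Algebra.Properties.CommutativeSemigroup (CommutativeRing.*-commutativeSemigroup ℤₚ[X])
    using (x∙yz≈y∙xz)
  open ℤ-Solver ℤₚ[X] using (solve; _:=_; _:+_; _:*_; _:-_)
  open Chebyshev ℤₚ[X] using (Tᴿ)

  X : Poly
  X = + 0 ∷ + 1 ∷ []

  X*≅X⊗ : ∀ f → X* f ≅ X ⊗ f
  X*≅X⊗ f = ≅-sym (⊕-cong (0· f) (X*-cong (⊗-identityˡ f)))

  2·X*≅ : ∀ f → (+ 2) · X* f ≅ (X ⊕ X) ⊗ f
  2·X*≅ f = begin
    (+ 2) · X* f                     ≈⟨ X*-· (+ 2) f ⟨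
    X* ((+ 2) · f)                   ≈⟨ X*-cong (≅-trans (⊕-cong (≅-refl {(+ 2) · f}) X*-[]) (⊕-identityʳ _)) ⟨
    X* ((+ 2) · f ⊕ X* [])           ≈⟨ ⊕-cong (0· f) ≅-refl ⟨
    (X ⊕ X) ⊗ f                      ∎

  T≅Tᴿ : ∀ n → T n ≅ Tᴿ n X
  T≅Tᴿ 0             = ≅-refl
  T≅Tᴿ 1             = ≅-refl
  T≅Tᴿ (suc (suc n)) = ⊕-cong (≅-trans (2·X*≅ (T (suc n))) (⊗-congʳ (X ⊕ X) (T≅Tᴿ (suc n)))) (·-congʳ _ (T≅Tᴿ n))

  eval-≅0 : ∀ {f} → f ≅ [] → ∀ a → eval f a ≋ + 0
  eval-≅0 {[]}    f≅0 a = ≋-refl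
  eval-≅0 {b ∷ f} f≅0 a = ≋-trans (+-cong (coeff-≋ f≅0 0) (*-cong (≋-refl {a}) (eval-≅0 tail≅0 a)))
                                  (≡⇒≋ (≡.trans (ℤ.+-identityˡ _) (ℤ.*-zeroʳ a)))
    where
    tail≅0 : f ≅ []
    tail≅0 = coeffwise λ k → coeff-≋ f≅0 (suc k)

  eval-cong : ∀ {f g} → f ≅ g → ∀ a → eval f a ≋ eval g a
  eval-cong {f} {g} f≅g a = ≋0⇒≋ (≡.subst (_≋ + 0) eval-difference (eval-≅0 (x≈y⇒x∙y⁻¹≈ε f≅g) a))
    where
    eval-difference : eval (f ⊕ neg g) a ≡ eval f a - eval g a
    eval-difference = ≡.trans (eval-⊕ f (neg g) a) (≡.cong (λ e → eval f a + e) (≡.trans (eval-· _ g a) (ℤ.-1*i≡-i _)))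

  private
    lin≅X-a : ∀ a → lin a ≅ X ⊕ neg (const a)
    lin≅X-a a = ≡ᶜ⇒≅ λ { zero          → ≡.sym (≡.trans (ℤ.+-identityˡ _) (ℤ.-1*i≡-i a))
                        ; (suc zero)    → ≡.refl
                        ; (suc (suc k)) → ≡.refl }

    const-* : ∀ a b → const (a * b) ≅ const a ⊗ const b
    const-* a b = ≡ᶜ⇒≅ λ { zero → ≡.sym (ℤ.+-identityʳ _) ; (suc k) → ≡.refl }

    ∷≅const⊕X⊗ : ∀ a f → a ∷ f ≅ const a ⊕ X ⊗ f
    ∷≅const⊕X⊗ a f = ≅-trans (∷-split a f) (⊕-cong (≅-refl {const a}) (X*≅X⊗ f))

  division : ∀ a f → f ≅ lin a ⊗ quotient a f ⊕ const (eval f a)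
  division a []          = ≅-sym (⊕-cong (⊗-zeroʳ (lin a)) (≡ᶜ⇒≅ {const (+ 0)} {[]} λ { zero → ≡.refl ; (suc k) → ≡.refl }))
  division a (b ∷ [])    = ≅-sym (⊕-cong (⊗-zeroʳ (lin a)) (≡ᶜ⇒≅ {const (b + a * + 0)} {const b} λ
                             { zero    → ≡.trans (≡.cong (λ e → b + e) (ℤ.*-zeroʳ a)) (ℤ.+-identityʳ b)
                             ; (suc k) → ≡.refl }))
  division a (b ∷ c ∷ g) = begin
    b ∷ g′                                            ≈⟨ ∷≅const⊕X⊗ b g′ ⟩
    B ⊕ X ⊗ g′                                        ≈⟨ ⊕-cong (≅-refl {B}) (⊗-congʳ X (≅-trans (division a (c ∷ g))
                                                           (⊕-cong (⊗-cong (lin≅X-a a) (≅-refl {Q})) (≅-refl {G})))) ⟩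
    B ⊕ X ⊗ ((X ⊕ neg A) ⊗ Q ⊕ G)                     ≈⟨ regroup B X A G Q ⟩
    (X ⊕ neg A) ⊗ (G ⊕ X ⊗ Q) ⊕ (B ⊕ A ⊗ G)           ≈⟨ ⊕-cong (⊗-cong (≅-sym (lin≅X-a a)) (≅-sym (∷≅const⊕X⊗ (eval g′ a) Q)))
                                                                 (⊕-cong (≅-refl {B}) (≅-sym (const-* a (eval g′ a)))) ⟩
    lin a ⊗ (eval g′ a ∷ Q) ⊕ const (b + a * eval g′ a) ∎
    where
    g′ = c ∷ g
    Q = quotient a g′
    A = const a
    B = const b
    G = const (eval g′ a)
    regroup : ∀ B X A G Q → B ⊕ X ⊗ ((X ⊕ neg A) ⊗ Q ⊕ G) ≅ (X ⊕ neg A) ⊗ (G ⊕ X ⊗ Q) ⊕ (B ⊕ A ⊗ G)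
    regroup = solve 5 (λ B X A G Q → B :+ X :* ((X :- A) :* Q :+ G) := (X :- A) :* (G :+ X :* Q) :+ (B :+ A :* G)) ≅-refl

  factor-theorem : ∀ a f → eval f a ≋ + 0 → f ≅ lin a ⊗ quotient a f
  factor-theorem a f root = ≅-trans (division a f)
    (≅-trans (⊕-cong (≅-refl {lin a ⊗ quotient a f}) (coeffwise λ { zero → root ; (suc k) → ≋-refl })) (⊕-identityʳ _))

  lin-⊗-≅0 : ∀ a w → lin a ⊗ w ≅ [] → w ≅ []
  lin-⊗-≅0 a w lin⊗w≅0 = coeffwise λ k → from-top (length w) k (ℕ.m≤n+m (length w) k)
    where
    recurrence : ∀ k → - a * coeff w (suc k) + coeff w k ≋ + 0
    recurrence k = ≋-trans (≡⇒≋ (≡.sym coefficient))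
                     (≋-trans (coeff-≋ (≅-sym (⊕-cong (≅-refl {(- a) · w}) (X*-cong (⊗-identityˡ w)))) (suc k))
                              (coeff-≋ lin⊗w≅0 (suc k)))
      where
      coefficient : coeff ((- a) · w ⊕ X* w) (suc k) ≡ - a * coeff w (suc k) + coeff w k
      coefficient = ≡.trans (coeff-⊕ ((- a) · w) (X* w) (suc k)) (≡.cong (_+ coeff w k) (coeff-· (- a) w (suc k)))

    from-top : ∀ j k → length w ℕ.≤ k ℕ.+ j → coeff w k ≋ + 0
    from-top zero    k w≤k = ≡⇒≋ (coeff-≥length w (≡.subst (length w ℕ.≤_) (ℕ.+-identityʳ k) w≤k))
    from-top (suc j) k w≤k = ≋-trans (≡⇒≋ (≡.sym (unfold a (coeff w (suc k)) (coeff w k))))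
      (≋-trans (+-cong (recurrence k) (*-cong (≋-refl {a}) (from-top j (suc k) (≡.subst (length w ℕ.≤_) (ℕ.+-suc k j) w≤k))))
               (≡⇒≋ (≡.trans (ℤ.+-identityˡ _) (ℤ.*-zeroʳ a))))
      where
      unfold : ∀ a y x → - a * y + x + a * y ≡ x
      unfold = solve-∀

  lin-cancel : ∀ a {u v} → lin a ⊗ u ≅ lin a ⊗ v → u ≅ v
  lin-cancel a {u} {v} e = x∙y⁻¹≈ε⇒x≈y u v (lin-⊗-≅0 a (u ⊕ neg v) (≅-trans (x[y-z]≈xy-xz (lin a) u v) (x≈y⇒x∙y⁻¹≈ε e)))

  Deg≤ : ℕ → Poly → Set
  Deg≤ i f = ∀ k → i ℕ.< k → coeff f k ≋ + 0

  Deg≤-length : ∀ f → Deg≤ (length f) f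
  Deg≤-length f k f<k = ≡⇒≋ (coeff-≥length f (ℕ.<⇒≤ f<k))

  ⊗-leading : ∀ f g i j → Deg≤ i f → Deg≤ j g →
              (coeff (f ⊗ g) (i ℕ.+ j) ≋ coeff f i * coeff g j) × Deg≤ (i ℕ.+ j) (f ⊗ g)
  ⊗-leading []      g i       j _     _     = ≡⇒≋ (≡.sym (ℤ.*-zeroˡ (coeff g j))) , λ _ _ → ≋-refl
  ⊗-leading (b ∷ f) g zero    j deg-f deg-g = leading , degree
    where
    X*[f⊗g]≅0 : X* (f ⊗ g) ≅ []
    X*[f⊗g]≅0 = ≅-trans (X*-cong (⊗-cong {f} {[]} (coeffwise λ k → deg-f (suc k) (ℕ.s≤s ℕ.z≤n)) (≅-refl {g}))) X*-[]
    leading : coeff ((b ∷ f) ⊗ g) j ≋ b * coeff g j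
    leading = ≋-trans (≡⇒≋ (coeff-⊗-∷ b f g j))
                (≋-trans (+-cong (≋-refl {b * coeff g j}) (coeff-≋ X*[f⊗g]≅0 j)) (≡⇒≋ (ℤ.+-identityʳ _)))
    degree : Deg≤ j ((b ∷ f) ⊗ g)
    degree k j<k = ≋-trans (≡⇒≋ (coeff-⊗-∷ b f g k))
                     (≋-trans (+-cong (*-cong (≋-refl {b}) (deg-g k j<k)) (coeff-≋ X*[f⊗g]≅0 k))
                              (≡⇒≋ (≡.trans (ℤ.+-identityʳ _) (ℤ.*-zeroʳ b))))
  ⊗-leading (b ∷ f) g (suc i) j deg-f deg-g
    with ⊗-leading f g i j (λ k i<k → deg-f (suc k) (ℕ.s≤s i<k)) deg-g
  ... | leading , degree = leading′ , degree′
    where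
    leading′ : coeff ((b ∷ f) ⊗ g) (suc (i ℕ.+ j)) ≋ coeff f i * coeff g j
    leading′ = ≋-trans (≡⇒≋ (coeff-⊗-∷ b f g (suc (i ℕ.+ j))))
                 (≋-trans (+-cong (*-cong (≋-refl {b}) (deg-g (suc (i ℕ.+ j)) (ℕ.s≤s (ℕ.m≤n+m j i)))) leading)
                          (≡⇒≋ (≡.trans (≡.cong (_+ _) (ℤ.*-zeroʳ b)) (ℤ.+-identityˡ _))))
    degree′ : Deg≤ (suc (i ℕ.+ j)) ((b ∷ f) ⊗ g)
    degree′ (suc k) (ℕ.s≤s i+j<k) = ≋-trans (≡⇒≋ (coeff-⊗-∷ b f g (suc k)))
      (≋-trans (+-cong (*-cong (≋-refl {b}) (deg-g (suc k) (ℕ.s≤s (ℕ.≤-trans (ℕ.m≤n+m j i) (ℕ.<⇒≤ i+j<k))))) (degree k i+j<k))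
               (≡⇒≋ (≡.trans (ℤ.+-identityʳ _) (ℤ.*-zeroʳ b))))

  zero-or-leading : ∀ f i → Deg≤ i f → f ≅ [] ⊎ ∃[ j ] (Deg≤ j f × ¬ coeff f j ≋ + 0)
  zero-or-leading f zero deg with coeff f 0 ≋0?
  ... | yes f₀≋0 = inj₁ (coeffwise λ { zero → f₀≋0 ; (suc k) → deg (suc k) (ℕ.s≤s ℕ.z≤n) })
  ... | no  f₀≉0 = inj₂ (0 , deg , f₀≉0)
  zero-or-leading f (suc i) deg with coeff f (suc i) ≋0?
  ... | no  fᵢ≉0 = inj₂ (suc i , deg , fᵢ≉0)
  ... | yes fᵢ≋0 = zero-or-leading f i lower
    where
    lower : Deg≤ i f
    lower k i<k with ℕ.m≤n⇒m<n∨m≡n i<k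
    ... | inj₁ 1+i<k  = deg k 1+i<k
    ... | inj₂ ≡.refl = fᵢ≋0

  prodLin-++ : ∀ rs ss → prodLin (rs ++ ss) ≅ prodLin rs ⊗ prodLin ss
  prodLin-++ []       ss = ≅-sym (⊗-identityˡ (prodLin ss))
  prodLin-++ (r ∷ rs) ss = ≅-trans (⊗-congʳ (lin r) (prodLin-++ rs ss)) (≅-sym (⊗-assoc (lin r) (prodLin rs) (prodLin ss)))

  Splits : Poly → Set
  Splits g = ∃[ c ] ∃[ rs ] g ≅ c · prodLin rs

  Splits⇒SplitsMod : ∀ {g} → Splits g → SplitsMod p g
  Splits⇒SplitsMod (c , rs , g≅) = c , rs , λ k → ∣⇒∣ᵤ (∣difference (coeff-≋ g≅ k))

  residues : ℕ → List ℤ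
  residues n = map +_ (downFrom n)

  module _ (p-prime : Prime p) where

    divisor-of-unit-constant : ∀ {c} → ¬ c ≋ + 0 → ∀ q g → q ⊗ g ≅ const c → g ≅ const (coeff g 0)
    divisor-of-unit-constant c≉0 q g qg≅c
      with zero-or-leading q (length q) (Deg≤-length q) | zero-or-leading g (length g) (Deg≤-length g)
    ... | inj₁ q≅0 | _ = ⊥-elim (c≉0 (≋-trans (≋-sym (coeff-≋ qg≅c 0)) (coeff-≋ (⊗-cong q≅0 (≅-refl {g})) 0)))
    ... | inj₂ _ | inj₁ g≅0                 = coeffwise λ { zero → ≋-refl ; (suc k) → coeff-≋ g≅0 (suc k) }
    ... | inj₂ _ | inj₂ (zero , deg-g , _)  = coeffwise λ { zero → ≋-refl ; (suc k) → deg-g (suc k) (ℕ.s≤s ℕ.z≤n) }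
    ... | inj₂ (j , deg-q , qⱼ≉0) | inj₂ (suc i , deg-g , gᵢ≉0) =
      ⊥-elim ([ gᵢ≉0 , qⱼ≉0 ]′ (≋0-euclid p-prime
        (≋-trans (≋-sym (proj₁ (⊗-leading g q (suc i) j deg-g deg-q))) (coeff-≋ (≅-trans (⊗-comm g q) qg≅c) (suc (i ℕ.+ j))))))

    -- Each root r of q g = c ∏ (x - r) is a root of g or of q since 𝔽ₚ is a domain; divide it out and recurse.
    divisor-of-split-splits : ∀ rs {c} → ¬ c ≋ + 0 → ∀ q g → q ⊗ g ≅ c · prodLin rs → Splits g
    divisor-of-split-splits [] {c} c≉0 q g qg≅c = coeff g 0 , [] ,
      ≅-trans (divisor-of-unit-constant c≉0 q g (≅-trans qg≅c (·-const-one c))) (≅-sym (·-const-one (coeff g 0)))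
    divisor-of-split-splits (a ∷ rs) {c} c≉0 q g qg≅c with eval g a ≋0?
    ... | yes g[a]≋0 = root-of-g (divisor-of-split-splits rs c≉0 q (quotient a g) (lin-cancel a (begin
          lin a ⊗ (q ⊗ quotient a g)      ≈⟨ x∙yz≈y∙xz (lin a) q (quotient a g) ⟩
          q ⊗ (lin a ⊗ quotient a g)      ≈⟨ ⊗-congʳ q g≅ ⟨
          q ⊗ g                           ≈⟨ qg≅c ⟩
          c · (lin a ⊗ prodLin rs)        ≈⟨ ⊗-·ʳ c (lin a) (prodLin rs) ⟨
          lin a ⊗ (c · prodLin rs)        ∎)))
      where
      g≅ : g ≅ lin a ⊗ quotient a g
      g≅ = factor-theorem a g g[a]≋0
      root-of-g : Splits (quotient a g) → Splits g
      root-of-g (c′ , rs′ , quotient≅) = c′ , a ∷ rs′ , (begin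
          g                               ≈⟨ g≅ ⟩
          lin a ⊗ quotient a g            ≈⟨ ⊗-congʳ (lin a) quotient≅ ⟩
          lin a ⊗ (c′ · prodLin rs′)      ≈⟨ ⊗-·ʳ c′ (lin a) (prodLin rs′) ⟩
          c′ · prodLin (a ∷ rs′)          ∎)
    ... | no g[a]≉0 = divisor-of-split-splits rs c≉0 (quotient a q) g (lin-cancel a (begin
          lin a ⊗ (quotient a q ⊗ g)      ≈⟨ ⊗-assoc (lin a) (quotient a q) g ⟨
          (lin a ⊗ quotient a q) ⊗ g      ≈⟨ ⊗-cong (factor-theorem a q q[a]≋0) (≅-refl {g}) ⟨
          q ⊗ g                           ≈⟨ qg≅c ⟩
          c · (lin a ⊗ prodLin rs)        ≈⟨ ⊗-·ʳ c (lin a) (prodLin rs) ⟨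
          lin a ⊗ (c · prodLin rs)        ∎))
      where
      qg[a]≋0 : eval q a * eval g a ≋ + 0
      qg[a]≋0 = ≋-trans (≡⇒≋ (≡.sym (eval-⊗ q g a))) (≋-trans (eval-cong qg≅c a) (≡⇒≋ c∏[a]≡0))
        where
        c∏[a]≡0 : eval (c · (lin a ⊗ prodLin rs)) a ≡ + 0
        c∏[a]≡0 = ≡.trans (eval-· c (lin a ⊗ prodLin rs) a)
                    (≡.trans (≡.cong (c *_) (≡.trans (eval-⊗ (lin a) (prodLin rs) a)
                                               (≡.cong (_* eval (prodLin rs) a) (≡.trans (eval-lin a a) (ℤ.+-inverseʳ a)))))
                             (ℤ.*-zeroʳ c))
      q[a]≋0 : eval q a ≋ + 0
      q[a]≋0 = [ id , (λ g[a]≋0 → ⊥-elim (g[a]≉0 g[a]≋0)) ]′ (≋0-euclid p-prime qg[a]≋0)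

    vanishing⇒prodLin-factor : ∀ n → n ℕ.≤ p → ∀ f → (∀ m → m ℕ.< n → eval f (+ m) ≋ + 0) →
                               ∃[ h ] (f ≅ prodLin (residues n) ⊗ h × length h ≡ length f ℕ.∸ n)
    vanishing⇒prodLin-factor zero    _   f _     = f , ≅-sym (⊗-identityˡ f) , ≡.refl
    vanishing⇒prodLin-factor (suc n) n<p f roots =
      extend (vanishing⇒prodLin-factor n (ℕ.<⇒≤ n<p) (quotient (+ n) f) quotient-roots)
      where
      f≅ : f ≅ lin (+ n) ⊗ quotient (+ n) f
      f≅ = factor-theorem (+ n) f (roots n (ℕ.n<1+n n))

      quotient-roots : ∀ m → m ℕ.< n → eval (quotient (+ n) f) (+ m) ≋ + 0
      quotient-roots m m<n =
        [ (λ m-n≋0 → ⊥-elim (distinct-residues m<n n<p (≡.subst (_≋ + 0) (eval-lin (+ n) (+ m)) m-n≋0))) , id ]′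
          (≋0-euclid p-prime (≋-trans (≡⇒≋ (≡.sym (eval-⊗ (lin (+ n)) (quotient (+ n) f) (+ m))))
                                      (≋-trans (≋-sym (eval-cong f≅ (+ m))) (roots m (ℕ.m<n⇒m<1+n m<n)))))

      extend : ∃[ h ] (quotient (+ n) f ≅ prodLin (residues n) ⊗ h × length h ≡ length (quotient (+ n) f) ℕ.∸ n) →
               ∃[ h ] (f ≅ prodLin (residues (suc n)) ⊗ h × length h ≡ length f ℕ.∸ suc n)
      extend (h , quotient≅ , length-h) = h , (begin
          f                                              ≈⟨ f≅ ⟩
          lin (+ n) ⊗ quotient (+ n) f                   ≈⟨ ⊗-congʳ (lin (+ n)) quotient≅ ⟩
          lin (+ n) ⊗ (prodLin (residues n) ⊗ h)         ≈⟨ ⊗-assoc (lin (+ n)) (prodLin (residues n)) h ⟨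
          prodLin (residues (suc n)) ⊗ h                 ∎)
        , ≡.trans length-h (≡.trans (≡.cong (ℕ._∸ n) (length-quotient (+ n) f)) (ℕ.∸-+-assoc (length f) 1 n))

module QuadraticExtension (p : ℕ) (d : ℤ) where
  open Modulo p
  open import Data.Product using (_×_; proj₂)
  open import Data.Integer using (_+_; _*_; -_; _-_)
  open import Data.Integer.Tactic.RingSolver using (solve-∀)

  infix 4 _≈_
  record _≈_ (x y : ℤ × ℤ) : Set where
    constructor _and_
    field
      real : proj₁ x ≋ proj₁ y
      imaginary : proj₂ x ≋ proj₂ y
  open _≈_

  infixl 6 _⊞_
  infixl 7 _⊠_
  _⊞_ _⊠_ : ℤ × ℤ → ℤ × ℤ → ℤ × ℤ
  (a , b) ⊞ (c , e) = a + c , b + e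
  (a , b) ⊠ (c , e) = a * c + d * (b * e) , a * e + b * c

  ⊟_ : ℤ × ℤ → ℤ × ℤ
  ⊟ (a , b) = - a , - b

  ≡⇒≈ : ∀ {a b c e} → a ≡ c → b ≡ e → (a , b) ≈ (c , e)
  ≡⇒≈ a≡c b≡e = ≡⇒≋ a≡c and ≡⇒≋ b≡e

  ≈-refl : ∀ {x} → x ≈ x
  ≈-refl = ≋-refl and ≋-refl

  ≈-sym : ∀ {x y} → x ≈ y → y ≈ x
  ≈-sym (a and b) = ≋-sym a and ≋-sym b

  ≈-trans : ∀ {x y z} → x ≈ y → y ≈ z → x ≈ z
  ≈-trans (a and b) (c and e) = ≋-trans a c and ≋-trans b e

  ⊞-cong : ∀ {x x′ y y′} → x ≈ x′ → y ≈ y′ → x ⊞ y ≈ x′ ⊞ y′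
  ⊞-cong (a and b) (c and e) = +-cong a c and +-cong b e

  ⊠-cong : ∀ {x x′ y y′} → x ≈ x′ → y ≈ y′ → x ⊠ y ≈ x′ ⊠ y′
  ⊠-cong (a and b) (c and e) = +-cong (*-cong a c) (*-cong (≋-refl {d}) (*-cong b e)) and +-cong (*-cong a e) (*-cong b c)

  ⊟-cong : ∀ {x x′} → x ≈ x′ → ⊟ x ≈ ⊟ x′
  ⊟-cong (a and b) = -‿cong a and -‿cong b

  ℤₚ[√d] : CommutativeRing _ _
  ℤₚ[√d] = record
    { Carrier = ℤ × ℤ ; _≈_ = _≈_ ; _+_ = _⊞_ ; _*_ = _⊠_ ; -_ = ⊟_ ; 0# = + 0 , + 0 ; 1# = + 1 , + 0
    ; isCommutativeRing = record
      { isRing = record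
        { +-isAbelianGroup = record
          { isGroup = record
            { isMonoid = record
              { isSemigroup = record
                { isMagma = record
                  { isEquivalence = record
                    { refl = ≈-refl ; sym = ≈-sym ; trans = ≈-trans }
                  ; ∙-cong = ⊞-cong }
                ; assoc = λ (a , b) (c , e) (f , g) → ≡⇒≈ (ℤ.+-assoc a c f) (ℤ.+-assoc b e g) }
              ; identity = (λ (a , b) → ≡⇒≈ (ℤ.+-identityˡ a) (ℤ.+-identityˡ b))
                         , (λ (a , b) → ≡⇒≈ (ℤ.+-identityʳ a) (ℤ.+-identityʳ b)) }
            ; inverse = (λ (a , b) → ≡⇒≈ (ℤ.+-inverseˡ a) (ℤ.+-inverseˡ b))
                      , (λ (a , b) → ≡⇒≈ (ℤ.+-inverseʳ a) (ℤ.+-inverseʳ b))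
            ; ⁻¹-cong = ⊟-cong }
          ; comm = λ (a , b) (c , e) → ≡⇒≈ (ℤ.+-comm a c) (ℤ.+-comm b e) }
        ; *-cong = ⊠-cong
        ; *-assoc = λ (a , b) (c , e) (f , g) → ≡⇒≈ (assoc₁ a b c e f g d) (assoc₂ a b c e f g d)
        ; *-identity = (λ (a , b) → ≡⇒≈ (identityˡ₁ a b d) (identityˡ₂ a b))
                     , (λ (a , b) → ≡⇒≈ (identityʳ₁ a b d) (identityʳ₂ a b))
        ; distrib = (λ (a , b) (c , e) (f , g) → ≡⇒≈ (distribˡ₁ a b c e f g d) (distribˡ₂ a b c e f g))
                  , (λ (a , b) (c , e) (f , g) → ≡⇒≈ (distribʳ₁ a b c e f g d) (distribʳ₂ a b c e f g)) }
      ; *-comm = λ (a , b) (c , e) → ≡⇒≈ (comm₁ a b c e d) (comm₂ a b c e) } }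
    where
    assoc₁ : ∀ a b c e f g d → (a * c + d * (b * e)) * f + d * ((a * e + b * c) * g) ≡ a * (c * f + d * (e * g)) + d * (b * (c * g + e * f))
    assoc₁ = solve-∀
    assoc₂ : ∀ a b c e f g d → (a * c + d * (b * e)) * g + (a * e + b * c) * f ≡ a * (c * g + e * f) + b * (c * f + d * (e * g))
    assoc₂ = solve-∀
    identityˡ₁ : ∀ a b d → + 1 * a + d * (+ 0 * b) ≡ a
    identityˡ₁ = solve-∀
    identityˡ₂ : ∀ a b → + 1 * b + + 0 * a ≡ b
    identityˡ₂ = solve-∀
    identityʳ₁ : ∀ a b d → a * + 1 + d * (b * + 0) ≡ a
    identityʳ₁ = solve-∀
    identityʳ₂ : ∀ a b → a * + 0 + b * + 1 ≡ b
    identityʳ₂ = solve-∀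
    distribˡ₁ : ∀ a b c e f g d → a * (c + f) + d * (b * (e + g)) ≡ (a * c + d * (b * e)) + (a * f + d * (b * g))
    distribˡ₁ = solve-∀
    distribˡ₂ : ∀ a b c e f g → a * (e + g) + b * (c + f) ≡ (a * e + b * c) + (a * g + b * f)
    distribˡ₂ = solve-∀
    distribʳ₁ : ∀ a b c e f g d → (c + f) * a + d * ((e + g) * b) ≡ (c * a + d * (e * b)) + (f * a + d * (g * b))
    distribʳ₁ = solve-∀
    distribʳ₂ : ∀ a b c e f g → (c + f) * b + (e + g) * a ≡ (c * b + e * a) + (f * b + g * a)
    distribʳ₂ = solve-∀
    comm₁ : ∀ a b c e d → a * c + d * (b * e) ≡ c * a + d * (e * b)
    comm₁ = solve-∀
    comm₂ : ∀ a b c e → a * e + b * c ≡ c * b + e * a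
    comm₂ = solve-∀

module OddPrimeFixedPoints (m : ℕ) (p-prime : Prime (3 ℕ.+ m)) where
  open import Data.Product using (_×_)
  open import Data.Integer using (_+_; _*_; -_; _-_)
  open import Data.Integer.Tactic.RingSolver using (solve-∀)

  p : ℕ
  p = 3 ℕ.+ m

  open Modulo p

  -- In ℤₚ[√d] with d = a² - 1, the elements z = a + √d and w = a - √d satisfy z + w = 2a and z w = 1.
  T-prime-fixes : ∀ a → eval (T p) (+ a) ≋ + a
  T-prime-fixes a = ≋0⇒≋ ([ (λ 2≋0 → ⊥-elim (2≉0 2≋0)) , id ]′
                      (≋0-euclid p-prime (≋-trans (≡⇒≋ (double-difference (eval (T p) (+ a)) (+ a))) (≋⇒≋0 doubled))))
    where
    2≉0 : ¬ + 2 ≋ + 0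
    2≉0 = small-≉0 (ℕ.s≤s ℕ.z≤n) (ℕ.s≤s (ℕ.s≤s (ℕ.s≤s ℕ.z≤n)))

    d : ℤ
    d = + a * + a - + 1
    open QuadraticExtension p d
    open CommutativeRing ℤₚ[√d] using (1#)
    open import Algebra.Properties.Monoid.Mult (CommutativeRing.+-monoid ℤₚ[√d]) using () renaming (_×_ to _times_)
    open Chebyshev ℤₚ[√d] using (Tᴿ)
    open Frobenius ℤₚ[√d] using (Tᴿ-prime)

    times-1 : ∀ n → n times 1# ≡ (+ n , + 0)
    times-1 zero    = ≡.refl
    times-1 (suc n) rewrite times-1 n = ≡.refl

    x y z w : ℤ × ℤ
    x = + a , + 0
    y = + 0 , + 1
    z = + a , + 1
    w = + a , -[1+ 0 ]

    Tᴿ-embed : ∀ k → Tᴿ k x ≈ (eval (T k) (+ a) , + 0)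
    Tᴿ-embed 0             = ≡⇒≈ (≡.sym (T₀ (+ a))) ≡.refl
      where
      T₀ : ∀ a → + 1 + a * + 0 ≡ + 1
      T₀ = solve-∀
    Tᴿ-embed 1             = ≡⇒≈ (≡.sym (T₁ (+ a))) ≡.refl
      where
      T₁ : ∀ a → + 0 + a * (+ 1 + a * + 0) ≡ a
      T₁ = solve-∀
    Tᴿ-embed (suc (suc k)) = ≈-trans (⊞-cong (⊠-cong (≈-refl {x ⊞ x}) (Tᴿ-embed (suc k))) (⊟-cong (Tᴿ-embed k)))
                                     (≡⇒≈ (≡.trans (real-part (+ a) e₁ e₀ d) (≡.sym recurrence)) (imaginary-part (+ a) e₁))
      where
      e₀ = eval (T k) (+ a)
      e₁ = eval (T (suc k)) (+ a)
      recurrence : eval (T (2 ℕ.+ k)) (+ a) ≡ + 2 * (+ 0 + + a * e₁) + - (+ 1) * e₀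
      recurrence = ≡.trans (eval-⊕ ((+ 2) · X* (T (suc k))) (neg (T k)) (+ a))
                           (≡.cong₂ _+_ (eval-· (+ 2) (X* (T (suc k))) (+ a)) (eval-· (- (+ 1)) (T k) (+ a)))
      real-part : ∀ a e₁ e₀ d → (a + a) * e₁ + d * (+ 0 * + 0) + - e₀ ≡ + 2 * (+ 0 + a * e₁) + - (+ 1) * e₀
      real-part = solve-∀
      imaginary-part : ∀ a e₁ → (a + a) * + 0 + + 0 * e₁ + - (+ 0) ≡ + 0
      imaginary-part = solve-∀

    doubled : eval (T p) (+ a) + eval (T p) (+ a) ≋ + a + + a
    doubled = _≈_.real (≈-trans (⊞-cong (≈-sym (Tᴿ-embed p)) (≈-sym (Tᴿ-embed p)))
                                (Tᴿ-prime (2 ℕ.+ m) p-prime char a {x} {y} {z} {w} x≈a z≈x+y w≈x-y zw≈1))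
      where
      char : p times 1# ≈ (+ 0 , + 0)
      char = ≡.subst (_≈ (+ 0 , + 0)) (≡.sym (times-1 p)) (p≋0 and ≋-refl)
      x≈a : x ≈ a times 1#
      x≈a = ≡.subst (x ≈_) (≡.sym (times-1 a)) ≈-refl
      z≈x+y : z ≈ x ⊞ y
      z≈x+y = ≡⇒≈ (≡.sym (ℤ.+-identityʳ (+ a))) ≡.refl
      w≈x-y : w ≈ x ⊞ ⊟ y
      w≈x-y = ≡⇒≈ (≡.sym (ℤ.+-identityʳ (+ a))) ≡.refl
      zw≈1 : z ⊠ w ≈ (+ 1 , + 0)
      zw≈1 = ≡⇒≈ (norm-real (+ a)) (norm-imaginary (+ a))
        where
        norm-real : ∀ a → a * a + (a * a - + 1) * (+ 1 * -[1+ 0 ]) ≡ + 1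
        norm-real = solve-∀
        norm-imaginary : ∀ a → a * -[1+ 0 ] + + 1 * a ≡ + 0
        norm-imaginary = solve-∀

    double-difference : ∀ e a → + 2 * (e - a) ≡ e + e - (a + a)
    double-difference = solve-∀

module ChebyshevDegree where
  open import Data.Integer using (_+_; _*_; -_)
  open ≡.≡-Reasoning

  length-⊕ : ∀ f g → length (f ⊕ g) ≡ length f ℕ.⊔ length g
  length-⊕ []      g       = ≡.refl
  length-⊕ (a ∷ f) []      = ≡.sym (ℕ.⊔-identityʳ (suc (length f)))
  length-⊕ (a ∷ f) (b ∷ g) = ≡.cong suc (length-⊕ f g)

  length-· : ∀ c f → length (c · f) ≡ length f
  length-· c []      = ≡.refl
  length-· c (a ∷ f) = ≡.cong suc (length-· c f)

  length-T : ∀ n → length (T n) ≡ suc n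
  length-T 0             = ≡.refl
  length-T 1             = ≡.refl
  length-T (suc (suc n)) = begin
    length ((+ 2) · X* (T (suc n)) ⊕ neg (T n))                 ≡⟨ length-⊕ ((+ 2) · X* (T (suc n))) (neg (T n)) ⟩
    length ((+ 2) · X* (T (suc n))) ℕ.⊔ length (neg (T n))     ≡⟨ ≡.cong₂ ℕ._⊔_
                                                                     (≡.trans (length-· (+ 2) (X* (T (suc n)))) (≡.cong suc (length-T (suc n))))
                                                                     (≡.trans (length-· _ (T n)) (length-T n)) ⟩
    suc (suc (suc n)) ℕ.⊔ suc n                                 ≡⟨ ℕ.m≥n⇒m⊔n≡m (ℕ.m≤n⇒m≤1+n (ℕ.n≤1+n (suc n))) ⟩
    suc (suc (suc n))                                           ∎

  coeff-T-leading : ∀ n → coeff (T (suc n)) (suc n) ≡ + (2 ℕ.^ n)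
  coeff-T-leading zero    = ≡.refl
  coeff-T-leading (suc n) = begin
    coeff ((+ 2) · X* (T (suc n)) ⊕ neg (T n)) (2 ℕ.+ n)                  ≡⟨ coeff-⊕ ((+ 2) · X* (T (suc n))) (neg (T n)) (2 ℕ.+ n) ⟩
    coeff ((+ 2) · X* (T (suc n))) (2 ℕ.+ n) + coeff (neg (T n)) (2 ℕ.+ n) ≡⟨ ≡.cong₂ _+_ (coeff-· (+ 2) (X* (T (suc n))) (2 ℕ.+ n))
                                                                                (≡.trans (coeff-neg (T n) (2 ℕ.+ n)) (≡.cong -_ (coeff-≥length (T n) T-short))) ⟩
    + 2 * coeff (T (suc n)) (suc n) + - + 0                                ≡⟨ ℤ.+-identityʳ _ ⟩
    + 2 * coeff (T (suc n)) (suc n)                                        ≡⟨ ≡.cong (+ 2 *_) (coeff-T-leading n) ⟩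
    + 2 * + (2 ℕ.^ n)                                                      ≡⟨ ℤ.pos-* 2 (2 ℕ.^ n) ⟨
    + (2 ℕ.^ suc n)                                                        ∎
    where
    T-short : length (T n) ℕ.≤ 2 ℕ.+ n
    T-short = ≡.subst (ℕ._≤ 2 ℕ.+ n) (≡.sym (length-T n)) (ℕ.n≤1+n (suc n))


module OddPrime (m : ℕ) (p-prime : Prime (3 ℕ.+ m)) where
  open import Data.Product using (_×_)
  open import Data.Integer using (_+_; _*_; -_; _-_)
  open import Data.Integer.Tactic.RingSolver using (solve-∀)
  open ChebyshevDegree
  open OddPrimeFixedPoints m p-prime using (p; T-prime-fixes)
  open Modulo p
  open PolynomialsModulo p
  private module ℤₚ[X] = CommutativeRing ℤₚ[X]
  open Chebyshev ℤₚ[X] using (Tᴿ; Tᴿ-sub-one-product; Tᴿ-sub-one-∣)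
  open import Algebra.Definitions.RawMagma ℤₚ[X].*-rawMagma using (_∣_; _,_)
  open import Algebra.Properties.Magma.Divisibility ℤₚ[X].*-magma using (∣ʳ-respʳ-≈; ∣ʳ-respˡ-≈; x∣ʳyx)
  open import Algebra.Properties.Semigroup.Divisibility ℤₚ[X].*-semigroup using (∣ʳ-trans)
  open import Relation.Binary.Reasoning.Setoid ≅-setoid

  F : Poly
  F = T p ⊕ neg X

  F-roots : ∀ a → a ℕ.< p → eval F (+ a) ≋ + 0
  F-roots a _ = ≋-trans (≡⇒≋ eval-F) (≋⇒≋0 (T-prime-fixes a))
    where
    eval-X : ∀ a → - (+ 1) * (+ 0 + a * (+ 1 + a * + 0)) ≡ - a
    eval-X = solve-∀
    eval-F : eval F (+ a) ≡ eval (T p) (+ a) - + a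
    eval-F = ≡.trans (eval-⊕ (T p) (neg X) (+ a))
                     (≡.cong (λ e → eval (T p) (+ a) + e) (≡.trans (eval-· (- (+ 1)) X (+ a)) (eval-X (+ a))))

  length-F : length F ≡ suc p
  length-F = ≡.trans (length-⊕ (T p) (neg X))
                     (≡.trans (≡.cong (ℕ._⊔ 2) (length-T p)) (ℕ.m≥n⇒m⊔n≡m (ℕ.s≤s (ℕ.s≤s ℕ.z≤n))))

  coeff-F-leading : coeff F p ≡ + (2 ℕ.^ (2 ℕ.+ m))
  coeff-F-leading = ≡.trans (coeff-⊕ (T p) (neg X) p) (≡.trans (ℤ.+-identityʳ _) (coeff-T-leading (2 ℕ.+ m)))

  residuesₚ : List ℤ
  residuesₚ = residues p

  F-splits : ∃[ c ] (¬ c ≋ + 0 × F ≅ c · prodLin residuesₚ)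
  F-splits = constant-cofactor (vanishing⇒prodLin-factor p-prime p ℕ.≤-refl F F-roots)
    where
    singleton : ∀ h → length h ≡ 1 → h ≡ const (coeff h 0)
    singleton (c ∷ []) _ = ≡.refl

    constant-cofactor : ∃[ h ] (F ≅ prodLin residuesₚ ⊗ h × length h ≡ length F ℕ.∸ p) →
                        ∃[ c ] (¬ c ≋ + 0 × F ≅ c · prodLin residuesₚ)
    constant-cofactor (h , F≅ , length-h) = c , c≉0 , F≅c∏
      where
      c = coeff h 0
      F≅c∏ : F ≅ c · prodLin residuesₚ
      F≅c∏ = ≅-trans F≅ (≅-trans (≡.subst (λ h′ → prodLin residuesₚ ⊗ h ≅ prodLin residuesₚ ⊗ h′)
                                    (singleton h (≡.trans length-h (≡.trans (≡.cong (ℕ._∸ p) length-F) (ℕ.m+n∸n≡m 1 p))))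
                                    ≅-refl)
                                 (⊗-const (prodLin residuesₚ) c))
      c≉0 : ¬ c ≋ + 0
      c≉0 c≋0 = 2^-≉0 p-prime (ℕ.s≤s (ℕ.s≤s (ℕ.s≤s ℕ.z≤n))) (2 ℕ.+ m)
        (≋-trans (≡⇒≋ (≡.sym coeff-F-leading))
          (≋-trans (coeff-≋ F≅c∏ p)
            (≋-trans (≡⇒≋ (coeff-· c (prodLin residuesₚ) p)) (*-cong c≋0 (≋-refl {coeff (prodLin residuesₚ) p})))))

  T-minus-one : ℕ → Poly
  T-minus-one n = T n ⊕ const (- (+ 1))

  T-minus-one≅ : ∀ n → T-minus-one n ≅ Tᴿ n X ℤₚ[X].- ℤₚ[X].1#
  T-minus-one≅ n = ⊕-cong (T≅Tᴿ n) (≡ᶜ⇒≅ λ { zero → ≡.refl ; (suc k) → ≡.refl })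

  Tₚ₊₁-1 Tₚ₋₁-1 : Poly
  Tₚ₊₁-1 = Tᴿ (4 ℕ.+ m) X ℤₚ[X].- ℤₚ[X].1#
  Tₚ₋₁-1 = Tᴿ (2 ℕ.+ m) X ℤₚ[X].- ℤₚ[X].1#

  module _ (c : ℤ) (c≉0 : ¬ c ≋ + 0) (F≅c∏ : F ≅ c · prodLin residuesₚ) where

    split-product : Tₚ₊₁-1 ⊗ Tₚ₋₁-1 ≅ (c * c) · prodLin (residuesₚ ++ residuesₚ)
    split-product = begin
      Tₚ₊₁-1 ⊗ Tₚ₋₁-1                              ≈⟨ Tᴿ-sub-one-product X (2 ℕ.+ m) ⟩
      (Tᴿ p X ℤₚ[X].- X) ⊗ (Tᴿ p X ℤₚ[X].- X)     ≈⟨ ⊗-cong F≅ F≅ ⟩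
      (c · ∏) ⊗ (c · ∏)                            ≈⟨ ⊗-·ˡ c ∏ (c · ∏) ⟩
      c · (∏ ⊗ (c · ∏))                            ≈⟨ ·-congʳ c (⊗-·ʳ c ∏ ∏) ⟩
      c · (c · (∏ ⊗ ∏))                            ≈⟨ ·-assoc c c (∏ ⊗ ∏) ⟩
      (c * c) · (∏ ⊗ ∏)                            ≈⟨ ·-congʳ (c * c) (prodLin-++ residuesₚ residuesₚ) ⟨
      (c * c) · prodLin (residuesₚ ++ residuesₚ)   ∎
      where
      ∏ = prodLin residuesₚ
      F≅ : Tᴿ p X ℤₚ[X].- X ≅ c · ∏
      F≅ = ≅-trans (⊕-cong (≅-sym (T≅Tᴿ p)) (≅-refl {neg X})) F≅c∏

    T-minus-one-splits : ∀ n → n ℕ.∣ 2 ℕ.+ m ⊎ n ℕ.∣ 4 ℕ.+ m → Splits (T-minus-one n)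
    T-minus-one-splits n n∣p±1 = from-divisor (∣ʳ-respʳ-≈ split-product (∣ʳ-respˡ-≈ (≅-sym (T-minus-one≅ n)) (∣-product n∣p±1)))
      where
      ∣-product : n ℕ.∣ 2 ℕ.+ m ⊎ n ℕ.∣ 4 ℕ.+ m → (Tᴿ n X ℤₚ[X].- ℤₚ[X].1#) ∣ Tₚ₊₁-1 ⊗ Tₚ₋₁-1
      ∣-product (inj₁ n∣p-1) = ∣ʳ-trans (Tᴿ-sub-one-∣ n∣p-1 X) (x∣ʳyx Tₚ₋₁-1 Tₚ₊₁-1)
      ∣-product (inj₂ n∣p+1) = ∣ʳ-trans (Tᴿ-sub-one-∣ n∣p+1 X)
                                        (∣ʳ-respʳ-≈ (ℤₚ[X].*-comm Tₚ₋₁-1 Tₚ₊₁-1) (x∣ʳyx Tₚ₊₁-1 Tₚ₋₁-1))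

      from-divisor : T-minus-one n ∣ (c * c) · prodLin (residuesₚ ++ residuesₚ) → Splits (T-minus-one n)
      from-divisor (q , qT≅) = divisor-of-split-splits p-prime (residuesₚ ++ residuesₚ) c²≉0 q (T-minus-one n) qT≅
        where
        c²≉0 : ¬ c * c ≋ + 0
        c²≉0 c²≋0 = [ c≉0 , c≉0 ]′ (≋0-euclid p-prime c²≋0)

  T-minus-one-splits-mod-p : ∀ n → n ℕ.∣ p ℕ.∸ 1 ⊎ n ℕ.∣ p ℕ.+ 1 → SplitsMod p (T-minus-one n)
  T-minus-one-splits-mod-p n n∣p±1 =
    let c , c≉0 , F≅c∏ = F-splits
    in Splits⇒SplitsMod (T-minus-one-splits c c≉0 F≅c∏ n (Sum.map₂ (≡.subst (n ℕ.∣_) (ℕ.+-comm p 1)) n∣p±1))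

module CharacteristicTwo where
  open import Data.Integer using (-_)
  open import Relation.Nullary.Decidable using (from-no)

  -- Modulo 2 both T₁ - 1 = x - 1 and T₃ - 1 = 4x³ - 3x - 1 reduce to x - 1.
  T₁-minus-one-splits : SplitsMod 2 (T 1 ⊕ const (- (+ 1)))
  T₁-minus-one-splits = + 1 , + 1 ∷ [] , λ { 0 → ℕ._∣0 2 ; 1 → ℕ._∣0 2 ; 2 → ℕ._∣0 2 ; (suc (suc (suc k))) → ℕ._∣0 2 }

  T₃-minus-one-splits : SplitsMod 2 (T 3 ⊕ const (- (+ 1)))
  T₃-minus-one-splits = + 1 , + 1 ∷ [] , λ { 0 → ℕ._∣0 2 ; 1 → ℕ.divides 2 ≡.refl ; 2 → ℕ._∣0 2 ; 3 → ℕ.divides 2 ≡.refl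
                                         ; (suc (suc (suc (suc k)))) → ℕ._∣0 2 }

  T-minus-one-splits-mod-2 : ∀ n → ℕ.NonZero n → n ℕ.∣ 1 ⊎ n ℕ.∣ 3 → SplitsMod 2 (T n ⊕ const (- (+ 1)))
  T-minus-one-splits-mod-2 n _ (inj₁ n∣1) rewrite ℕ.∣1⇒≡1 n∣1 = T₁-minus-one-splits
  T-minus-one-splits-mod-2 1 _ (inj₂ _)   = T₁-minus-one-splits
  T-minus-one-splits-mod-2 2 _ (inj₂ 2∣3) = ⊥-elim (from-no (2 ℕ.∣? 3) 2∣3)
  T-minus-one-splits-mod-2 3 _ (inj₂ _)   = T₃-minus-one-splits
  T-minus-one-splits-mod-2 (suc (suc (suc (suc n)))) _ (inj₂ n∣3) =
    ⊥-elim (ℕ.<⇒≱ (ℕ.s≤s (ℕ.s≤s (ℕ.s≤s (ℕ.s≤s ℕ.z≤n)))) (ℕ.∣⇒≤ n∣3))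

open CharacteristicTwo using (T-minus-one-splits-mod-2)

open import Data.Nat using (ℕ; _+_; _∸_; NonZero)
open import Data.Nat.Divisibility using (_∣_)
open import Data.Nat.Primality using (Prime)
open import Data.Sum using (_⊎_)
open import Data.Integer using (+_; -_)
open import Data.Nat.Primality using (¬prime[0]; ¬prime[1])

lemma3p1 : (n p : ℕ) → NonZero n → Prime p →
    (n ∣ p ∸ 1) ⊎ (n ∣ p + 1) →
    SplitsMod p (T n ⊕ const (- (+ 1)))
lemma3p1 n 0 _ p-prime _ = ⊥-elim (¬prime[0] p-prime)
lemma3p1 n 1 _ p-prime _ = ⊥-elim (¬prime[1] p-prime)
lemma3p1 n 2 n≢0 _ n∣p±1 = T-minus-one-splits-mod-2 n n≢0 n∣p±1
lemma3p1 n (suc (suc (suc m))) _ p-prime n∣p±1 = OddPrime.T-minus-one-splits-mod-p m p-prime n n∣p±1
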